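{- For odd $n\geq3$ let $E_n$ denote the expected value of the length of a board chosen uniformly at random from the set $Sol_n$ of all solvable boards of size $n$. Then $$\lim_{n\to\infty} E_n=\frac{209}{96},$$ where the limit is taken over odd $n$.
   Context: Let $\mathcal{D}=\{\mathrm{N},\mathrm{NE},\mathrm{E},\mathrm{SE},\mathrm{S},\mathrm{SW},\mathrm{W},\mathrm{NW}\}$. For odd $n\geq 3$, a board of size $n$ is an $n\times n$ matrix $A=(a_{ij})$ with entries in $\mathcal{D}$; rows are indexed $1,\dots,n$ from top to bottom, columns from left to right. For $(i',j')\neq(i,j)$, $a_{ij}$ is directing to $(i',j')$ if: N: $j'=j$, $i'<i$; NE: $i-i'=j'-j>0$; E: $i'=i$, $j'>j$; SE: $i'-i=j'-j>0$; S: $j'=j$, $i'>i$; SW: $i'-i=j-j'>0$; W: $i'=i$, $j'<j$; NW: $i-i'=j-j'>0$. A move goes from $(i,j)$ to any position to which $a_{ij}$ is directing. $A$ is solvable if some finite sequence of moves leads from $(1,1)$ to the center $(\frac{n+1}{2},\frac{n+1}{2})$; the length of a solvable board is the minimal number of moves in such a sequence. $Sol_n$ is the (nonempty, finite) set of solvable boards of size $n$, equipped with the uniform probability measure. -}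

module Defs where

open import Data.Nat using (ℕ; zero; suc; _+_; _∸_; _<_; _/_)
open import Data.Fin using (Fin; toℕ)
open import Data.Vec using (Vec; lookup)
open import Data.Product using (_×_; ∃; Σ)
open import Data.List using (List; []; _∷_; length; map)
open import Data.Nat.ListAction using (sum)
open import Data.Integer using (+_)
open import Relation.Binary.PropositionalEquality using (_≡_)
import Data.Rational as ℚ

data Dir : Set where
  N NE E SE S SW W NW : Dir

-- A board of size n: an n×n matrix with entries in Dir
-- (row-major: outer vector = rows, top to bottom; inner = columns, left to right).
Board : ℕ → Set
Board n = Vec (Vec Dir n) n

-- Positions; coordinates are 0-indexed (row i corresponds to row i+1 of the paper).
-- All conditions in the paper are translation invariant, so this is harmless.
Pos : ℕ → Set
Pos n = Fin n × Fin n

entry : ∀ {n} → Board n → Pos n → Dir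
entry A (i Data.Product., j) = lookup (lookup A i) j

DirectsTo : Dir → ℕ → ℕ → ℕ → ℕ → Set
DirectsTo N  i j i' j' = (j' ≡ j) × (i' < i)
DirectsTo NE i j i' j' = (i' < i) × (j < j') × (i ∸ i' ≡ j' ∸ j)
DirectsTo E  i j i' j' = (i' ≡ i) × (j < j')
DirectsTo SE i j i' j' = (i < i') × (j < j') × (i' ∸ i ≡ j' ∸ j)
DirectsTo S  i j i' j' = (j' ≡ j) × (i < i')
DirectsTo SW i j i' j' = (i < i') × (j' < j) × (i' ∸ i ≡ j ∸ j')
DirectsTo W  i j i' j' = (i' ≡ i) × (j' < j)
DirectsTo NW i j i' j' = (i' < i) × (j' < j) × (i ∸ i' ≡ j ∸ j')

Move : ∀ {n} → Board n → Pos n → Pos n → Set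
Move A (i Data.Product., j) (i' Data.Product., j') =
  DirectsTo (entry A (i Data.Product., j)) (toℕ i) (toℕ j) (toℕ i') (toℕ j')

data Path {n : ℕ} (A : Board n) : ℕ → Pos n → Pos n → Set where
  stop : ∀ {p} → Path A 0 p p
  step : ∀ {k p q r} → Move A p q → Path A k q r → Path A (suc k) p r

-- (1,1) in the paper's 1-indexed coordinates.
IsStart : ∀ {n} → Pos n → Set
IsStart (i Data.Product., j) = (toℕ i ≡ 0) × (toℕ j ≡ 0)

-- The centre ((n+1)/2,(n+1)/2) in 1-indexed coordinates is (⌊n/2⌋,⌊n/2⌋) 0-indexed, n odd.
IsCenter : ∀ {n} → Pos n → Set
IsCenter {n} (i Data.Product., j) = (toℕ i ≡ n / 2) × (toℕ j ≡ n / 2)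

SolvesIn : ∀ {n} → Board n → ℕ → Set
SolvesIn A k = Σ _ λ p → Σ _ λ q → IsStart p × IsCenter q × Path A k p q

Solvable : ∀ {n} → Board n → Set
Solvable A = ∃ λ k → SolvesIn A k

IsLength : ∀ {n} → Board n → ℕ → Set
IsLength A ℓ = SolvesIn A ℓ × (∀ k → k < ℓ → SolvesIn A k → Data.Empty.⊥)
  where import Data.Empty

-- Arithmetic mean of a list of naturals, as a rational (0 for the empty list).
mean : List ℕ → ℚ.ℚ
mean [] = ℚ.0ℚ
mean (x ∷ xs) = (+ sum (x ∷ xs)) ℚ./ suc (length xs)

{-# OPTIONS --safe #-}
-- Write n = 2t + 3 and index rows and columns from 0, so that the centre is (t + 1, t + 1). Only
-- the corner arrows SE, S and E allow a first move, and transposing the board (reflecting every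
-- arrow) exchanges S and E. Corner SE gives length 1. With corner S the length is 2 unless rows
-- t + 1 and 2t + 2 avoid the two arrows leading into the centre, which happens for a fraction
-- 49/64 of the boards; it is then 3 unless each row in [1, t] avoids a detour through column t + 1,
-- a fraction (63/64)^t; the remaining boards have length < n², a negligible contribution. Each
-- corner occurs on 1/8 of all boards, so the mean tends to (1 + 2 (2·15 + 3·49)/64) / 3 = 209/96.
module Submission where

open import Defs

module MeanLength where

  open import Data.Bool using (Bool; true; false; if_then_else_; _∧_; not)
  open import Data.Bool.Properties using (∧-conicalˡ; ∧-conicalʳ; T-≡; ¬-not; not-injective)
  open import Data.Empty using (⊥-elim)
  open import Data.Sum using (_⊎_; inj₁; inj₂)
  open import Data.Nat
  open import Data.Nat.Properties
  open import Algebra.Properties.CommutativeSemigroup +-commutativeSemigroup using (x∙yz≈y∙xz)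
  open import Data.List using (List; []; _∷_; _++_; map; length; cartesianProductWith; allFin)
  open import Data.List.Properties using (length-tabulate; length-map)
  open import Data.List.Membership.Propositional using (_∈_)
  open import Data.List.Membership.Propositional.Properties
    using (∈-cartesianProductWith⁺; ∈-map⁺; ∈-allFin)
  open import Data.List.Relation.Unary.Any using (here; there; _─_)
  open import Data.List.Relation.Unary.All as All using ([]; _∷_)
  open import Data.List.Relation.Unary.All.Properties using (¬Any⇒All¬)
  open import Data.List.Relation.Unary.AllPairs using ([]; _∷_)
  open import Data.List.Relation.Unary.Unique.Propositional using (Unique)
  open import Data.List.Relation.Unary.Unique.Propositional.Properties
    using (cartesianProductWith⁺; map⁺)
  open import Data.Nat.ListAction using (sum)
  open import Data.Integer as ℤ using (ℤ; -[1+_]; _⊖_)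
  import Data.Integer.Properties as ℤ
  open import Data.Rational as ℚ using (ℚ; mkℚ; 0ℚ)
  import Data.Rational.Properties as ℚ
  import Data.Rational.Unnormalised.Base as ℚᵘ
  import Data.Rational.Unnormalised.Properties as ℚᵘ
  open import Data.Nat.DivMod using (/-congˡ; +-distrib-/-∣ʳ; m*n/n≡m; m≡m%n+[m/n]*n)
  open import Data.Nat.Divisibility using (divides)
  open import Function.Bundles using (Equivalence; _⇔_)
  open import Data.Product using (_×_; _,_; Σ; ∃; proj₁; proj₂)
  open import Data.Vec as Vec using (Vec; []; _∷_; lookup)
  open import Data.Vec.Properties using (∷-injective; lookup∘tabulate; tabulate∘lookup; tabulate-cong)
  open import Data.Fin as Fin using (Fin; toℕ)
  open import Data.Fin.Properties using (toℕ-injective; toℕ<n; toℕ-fromℕ<)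
  open import Relation.Binary.PropositionalEquality
  open import Relation.Binary.Definitions using (tri<; tri≈; tri>)
  open import Relation.Nullary using (¬_; yes; no)
  open import Data.Product.Properties using (≡-dec)
  import Data.List.Membership.DecPropositional as DecMembership
  open import Function using (id; const)
  open import Data.Nat.Tactic.RingSolver

  -- Counting over lists

  module _ {A : Set} where

    sumWhere : (A → Bool) → (A → ℕ) → List A → ℕ
    sumWhere p f []       = 0
    sumWhere p f (x ∷ xs) = (if p x then f x else 0) + sumWhere p f xs

    count : (A → Bool) → List A → ℕ
    count p = sumWhere p (λ _ → 1)

    sumWhere-++ : ∀ p f (xs ys : List A) →
                  sumWhere p f (xs ++ ys) ≡ sumWhere p f xs + sumWhere p f ys
    sumWhere-++ p f []       ys = refl
    sumWhere-++ p f (x ∷ xs) ys =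
      trans (cong (head +_) (sumWhere-++ p f xs ys)) (sym (+-assoc head _ _))
      where head = if p x then f x else 0

    sumWhere-cong : ∀ {p q : A → Bool} f xs → (∀ x → p x ≡ q x) →
                    sumWhere p f xs ≡ sumWhere q f xs
    sumWhere-cong f []       p≡q = refl
    sumWhere-cong f (x ∷ xs) p≡q =
      cong₂ (λ b s → (if b then f x else 0) + s) (p≡q x) (sumWhere-cong f xs p≡q)

    sumWhere-split : ∀ (p q : A → Bool) f xs → (∀ x → q x ≡ true → p x ≡ true) →
                     sumWhere p f xs ≡ sumWhere (λ x → p x ∧ not (q x)) f xs + sumWhere q f xs
    sumWhere-split p q f []       q⇒p = refl
    sumWhere-split p q f (x ∷ xs) q⇒p
      rewrite sumWhere-split p q f xs q⇒p with q x in qx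
    ... | true  rewrite q⇒p x qx = x∙yz≈y∙xz (f x) (sumWhere (λ x → p x ∧ not (q x)) f xs) (sumWhere q f xs)
    ... | false with p x
    ...   | true  = sym (+-assoc (f x) _ _)
    ...   | false = refl

    sumWhere-const : ∀ p f a xs → (∀ x → x ∈ xs → p x ≡ true → f x ≡ a) →
                     sumWhere p f xs ≡ a * count p xs
    sumWhere-const p f a []       f≡a = sym (*-zeroʳ a)
    sumWhere-const p f a (x ∷ xs) f≡a with p x in px
    ... | true  = trans (cong₂ _+_ (f≡a x (here refl) px) (sumWhere-const p f a xs (λ y y∈ → f≡a y (there y∈))))
                        (sym (*-suc a _))
    ... | false = sumWhere-const p f a xs (λ y y∈ → f≡a y (there y∈))

    sumWhere-≤ : ∀ p f a xs → (∀ x → x ∈ xs → p x ≡ true → f x ≤ a) →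
                 sumWhere p f xs ≤ a * count p xs
    sumWhere-≤ p f a []       f≤a = ≤-reflexive (sym (*-zeroʳ a))
    sumWhere-≤ p f a (x ∷ xs) f≤a with p x in px
    ... | true  = ≤-trans (+-mono-≤ (f≤a x (here refl) px) (sumWhere-≤ p f a xs (λ y y∈ → f≤a y (there y∈))))
                          (≤-reflexive (sym (*-suc a _)))
    ... | false = sumWhere-≤ p f a xs (λ y y∈ → f≤a y (there y∈))

    sumWhere-none : ∀ p f xs → (∀ x → x ∈ xs → p x ≡ false) → sumWhere p f xs ≡ 0
    sumWhere-none p f []       none = refl
    sumWhere-none p f (x ∷ xs) none
      rewrite none x (here refl) = sumWhere-none p f xs (λ y y∈ → none y (there y∈))

    sum-map : ∀ (f : A → ℕ) xs → sum (map f xs) ≡ sumWhere (λ _ → true) f xs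
    sum-map f []       = refl
    sum-map f (x ∷ xs) = cong (f x +_) (sum-map f xs)

    count-true : ∀ xs → count (λ _ → true) xs ≡ length xs
    count-true []       = refl
    count-true (x ∷ xs) = cong suc (count-true xs)

    count-─ : ∀ p {x : A} (ys : List A) (x∈ys : x ∈ ys) → p x ≡ true → count p ys ≡ suc (count p (ys ─ x∈ys))
    count-─ p (y ∷ ys) (here refl) px rewrite px = refl
    count-─ p (y ∷ ys) (there x∈ys) px with p y
    ... | true  = cong suc (count-─ p ys x∈ys px)
    ... | false = count-─ p ys x∈ys px

    ∈-─ : ∀ {x y : A} (ys : List A) (x∈ys : x ∈ ys) → y ∈ ys → y ≢ x → y ∈ (ys ─ x∈ys)
    ∈-─ (z ∷ ys) (here refl)  (here refl)  y≢x = ⊥-elim (y≢x refl)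
    ∈-─ (z ∷ ys) (here refl)  (there y∈ys) y≢x = y∈ys
    ∈-─ (z ∷ ys) (there x∈ys) (here refl)  y≢x = here refl
    ∈-─ (z ∷ ys) (there x∈ys) (there y∈ys) y≢x = there (∈-─ ys x∈ys y∈ys y≢x)

    count-mono : ∀ p xs ys → Unique xs → (∀ x → x ∈ xs → p x ≡ true → x ∈ ys) →
                 count p xs ≤ count p ys
    count-mono p []       ys u        ⊆ys = z≤n
    count-mono p (x ∷ xs) ys (x∉ ∷ u) ⊆ys with p x in px
    ... | false = count-mono p xs ys u (λ y y∈ → ⊆ys y (there y∈))
    ... | true  = ≤-trans (s≤s (count-mono p xs (ys ─ x∈ys) u ⊆ys─x))
                          (≤-reflexive (sym (count-─ p ys x∈ys px)))
      where
      x∈ys : x ∈ ys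
      x∈ys = ⊆ys x (here refl) px
      ⊆ys─x : ∀ y → y ∈ xs → p y ≡ true → y ∈ (ys ─ x∈ys)
      ⊆ys─x y y∈ py = ∈-─ ys x∈ys (⊆ys y (there y∈) py) (λ y≡x → All.lookup x∉ y∈ (sym y≡x))

    count-≡ : ∀ p xs ys → Unique xs → Unique ys →
              (∀ x → p x ≡ true → x ∈ xs → x ∈ ys) → (∀ x → p x ≡ true → x ∈ ys → x ∈ xs) →
              count p xs ≡ count p ys
    count-≡ p xs ys uxs uys xs⊆ys ys⊆xs =
      ≤-antisym (count-mono p xs ys uxs (λ x x∈ px → xs⊆ys x px x∈))
                (count-mono p ys xs uys (λ x x∈ px → ys⊆xs x px x∈))

  sumWhere-map : ∀ {A B : Set} p f (g : A → B) xs →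
                 sumWhere p f (map g xs) ≡ sumWhere (λ x → p (g x)) (λ x → f (g x)) xs
  sumWhere-map p f g []       = refl
  sumWhere-map p f g (x ∷ xs) = cong (_ +_) (sumWhere-map p f g xs)

  count-involution : ∀ {A : Set} (f : A → A) → (∀ x → f (f x) ≡ x) → ∀ p xs → Unique xs → (∀ x → x ∈ xs) →
                     count (λ x → p (f x)) xs ≡ count p xs
  count-involution f f∘f≡id p xs u ∈xs = begin
    count (λ x → p (f x)) xs ≡⟨ sumWhere-map p (λ _ → 1) f xs ⟨
    count p (map f xs)       ≡⟨ count-≡ p (map f xs) xs (map⁺ f-injective u) u (λ x _ _ → ∈xs x)
                                        (λ x _ _ → subst (_∈ map f xs) (f∘f≡id x) (∈-map⁺ f (∈xs (f x)))) ⟩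
    count p xs               ∎
    where
    open ≡-Reasoning
    f-injective : ∀ {x y} → f x ≡ f y → x ≡ y
    f-injective {x} {y} fx≡fy = trans (sym (f∘f≡id x)) (trans (cong f fx≡fy) (f∘f≡id y))

  count-cartesianProductWith : ∀ {A B C : Set} (f : A → B → C) (r : C → Bool) p q xs ys →
    (∀ a b → r (f a b) ≡ p a ∧ q b) →
    count r (cartesianProductWith f xs ys) ≡ count p xs * count q ys
  count-cartesianProductWith f r p q []       ys r≡ = refl
  count-cartesianProductWith f r p q (x ∷ xs) ys r≡ = begin
    count r (map (f x) ys ++ cartesianProductWith f xs ys)
      ≡⟨ sumWhere-++ r _ (map (f x) ys) _ ⟩
    count r (map (f x) ys) + count r (cartesianProductWith f xs ys)
      ≡⟨ cong₂ _+_ (trans (sumWhere-map r _ (f x) ys) (sumWhere-cong _ ys (r≡ x)))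
                   (count-cartesianProductWith f r p q xs ys r≡) ⟩
    count (λ y → p x ∧ q y) ys + count p xs * count q ys
      ≡⟨ head-case (p x) ⟩
    ((if p x then 1 else 0) + count p xs) * count q ys ∎
    where
    open ≡-Reasoning
    head-case : ∀ b → count (λ y → b ∧ q y) ys + count p xs * count q ys
                    ≡ ((if b then 1 else 0) + count p xs) * count q ys
    head-case true  = trans (cong (_+ count p xs * count q ys) (sym (*-identityˡ (count q ys))))
                            (sym (*-distribʳ-+ (count q ys) 1 (count p xs)))
    head-case false = cong (_+ count p xs * count q ys) (sumWhere-none (λ y → false ∧ q y) _ ys (λ _ _ → refl))

  vectors : ∀ {A : Set} n → List A → List (Vec A n)
  vectors zero    xs = [] ∷ []
  vectors (suc n) xs = cartesianProductWith _∷_ xs (vectors n xs)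

  ∈-vectors : ∀ {A : Set} {xs : List A} n → (∀ x → x ∈ xs) → ∀ v → v ∈ vectors n xs
  ∈-vectors zero    ∈xs []      = here refl
  ∈-vectors (suc n) ∈xs (x ∷ v) = ∈-cartesianProductWith⁺ _∷_ (∈xs x) (∈-vectors n ∈xs v)

  vectors-unique : ∀ {A : Set} {xs : List A} n → Unique xs → Unique (vectors n xs)
  vectors-unique zero    u = [] ∷ []
  vectors-unique (suc n) u = cartesianProductWith⁺ _∷_ ∷-injective u (vectors-unique n u)

  count-vectors : ∀ {A : Set} n (xs : List A) → count (λ _ → true) (vectors n xs) ≡ length xs ^ n
  count-vectors zero    xs = refl
  count-vectors (suc n) xs =
    trans (count-cartesianProductWith _∷_ _ _ _ xs (vectors n xs) (λ _ _ → refl))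
          (cong₂ _*_ (count-true xs) (count-vectors n xs))

  module _ {A : Set} where

    allFrom : ∀ {n} → (ℕ → A → Bool) → ℕ → Vec A n → Bool
    allFrom Q k []      = true
    allFrom Q k (x ∷ v) = Q k x ∧ allFrom Q (suc k) v

    allFrom-lookup : ∀ {n} Q k (v : Vec A n) → allFrom Q k v ≡ true →
                     ∀ i → Q (k + toℕ i) (lookup v i) ≡ true
    allFrom-lookup Q k (x ∷ v) all Fin.zero
      rewrite +-identityʳ k = ∧-conicalˡ (Q k x) _ all
    allFrom-lookup Q k (x ∷ v) all (Fin.suc i)
      rewrite +-suc k (toℕ i) = allFrom-lookup Q (suc k) v (∧-conicalʳ (Q k x) _ all) i

    allFrom-false : ∀ {n} Q k (v : Vec A n) → allFrom Q k v ≡ false →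
                    Σ (Fin n) λ i → Q (k + toℕ i) (lookup v i) ≡ false
    allFrom-false Q k (x ∷ v) none with Q k x in qx
    ... | false = Fin.zero , subst (λ j → Q j x ≡ false) (sym (+-identityʳ k)) qx
    ... | true with allFrom-false Q (suc k) v none
    ...   | i , qi = Fin.suc i , subst (λ j → Q j (lookup v i) ≡ false) (sym (+-suc k (toℕ i))) qi

    allFrom-mono : ∀ {n} Q Q′ k (v : Vec A n) → (∀ i x → Q i x ≡ true → Q′ i x ≡ true) →
                   allFrom Q k v ≡ true → allFrom Q′ k v ≡ true
    allFrom-mono Q Q′ k []      Q⇒Q′ all = refl
    allFrom-mono Q Q′ k (x ∷ v) Q⇒Q′ all =
      cong₂ _∧_ (Q⇒Q′ k x (∧-conicalˡ (Q k x) _ all))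
                (allFrom-mono Q Q′ (suc k) v Q⇒Q′ (∧-conicalʳ (Q k x) _ all))

  productFrom : (ℕ → ℕ) → ℕ → ℕ → ℕ
  productFrom f k zero    = 1
  productFrom f k (suc n) = f k * productFrom f (suc k) n

  productFrom-+ : ∀ f k a b → productFrom f k (a + b) ≡ productFrom f k a * productFrom f (k + a) b
  productFrom-+ f k zero    b rewrite +-identityʳ k = sym (+-identityʳ _)
  productFrom-+ f k (suc a) b rewrite productFrom-+ f (suc k) a b | +-suc k a =
    sym (*-assoc (f k) _ _)

  productFrom-const : ∀ f c k a → (∀ i → k ≤ i → i < k + a → f i ≡ c) → productFrom f k a ≡ c ^ a
  productFrom-const f c k zero    f≡c = refl
  productFrom-const f c k (suc a) f≡c = cong₂ _*_
    (f≡c k ≤-refl (≤-trans (s≤s (m≤m+n k a)) (≤-reflexive (sym (+-suc k a)))))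
    (productFrom-const f c (suc k) a (λ i k<i i< → f≡c i (<⇒≤ k<i) (≤-trans i< (≤-reflexive (sym (+-suc k a))))))

  count-allFrom-vectors : ∀ {A : Set} n (Q : ℕ → A → Bool) k xs →
    count (allFrom Q k) (vectors n xs) ≡ productFrom (λ i → count (Q i) xs) k n
  count-allFrom-vectors zero    Q k xs = refl
  count-allFrom-vectors (suc n) Q k xs =
    trans (count-cartesianProductWith _∷_ (allFrom Q k) (Q k) (allFrom Q (suc k)) xs (vectors n xs) (λ _ _ → refl))
          (cong (count (Q k) xs *_) (count-allFrom-vectors n Q (suc k) xs))

  ≡ᵇ-true⇒≡ : ∀ m n → (m ≡ᵇ n) ≡ true → m ≡ n
  ≡ᵇ-true⇒≡ m n eq = ≡ᵇ⇒≡ m n (Equivalence.from T-≡ eq)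

  ≡ᵇ-refl : ∀ m → (m ≡ᵇ m) ≡ true
  ≡ᵇ-refl m = Equivalence.to T-≡ (≡⇒≡ᵇ m m refl)

  ≢⇒≡ᵇ-false : ∀ {m n} → m ≢ n → (m ≡ᵇ n) ≡ false
  ≢⇒≡ᵇ-false {m} {n} m≢n = ¬-not (λ eq → m≢n (≡ᵇ-true⇒≡ m n eq))

  <⇒<ᵇ-true : ∀ {m n} → m < n → (m <ᵇ n) ≡ true
  <⇒<ᵇ-true m<n = Equivalence.to T-≡ (<⇒<ᵇ m<n)

  ≥⇒<ᵇ-false : ∀ {m n} → n ≤ m → (m <ᵇ n) ≡ false
  ≥⇒<ᵇ-false {m} {n} n≤m = ¬-not (λ eq → <⇒≱ (<ᵇ⇒< m n (Equivalence.from T-≡ eq)) n≤m)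

  dirCode : Dir → ℕ
  dirCode N  = 0
  dirCode NE = 1
  dirCode E  = 2
  dirCode SE = 3
  dirCode S  = 4
  dirCode SW = 5
  dirCode W  = 6
  dirCode NW = 7

  decodeDir : ℕ → Dir
  decodeDir 0 = N
  decodeDir 1 = NE
  decodeDir 2 = E
  decodeDir 3 = SE
  decodeDir 4 = S
  decodeDir 5 = SW
  decodeDir 6 = W
  decodeDir _ = NW

  decodeDir-dirCode : ∀ d → decodeDir (dirCode d) ≡ d
  decodeDir-dirCode N  = refl
  decodeDir-dirCode NE = refl
  decodeDir-dirCode E  = refl
  decodeDir-dirCode SE = refl
  decodeDir-dirCode S  = refl
  decodeDir-dirCode SW = refl
  decodeDir-dirCode W  = refl
  decodeDir-dirCode NW = refl

  _==ᴰ_ : Dir → Dir → Bool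
  d ==ᴰ e = dirCode d ≡ᵇ dirCode e

  ==ᴰ-refl : ∀ d → (d ==ᴰ d) ≡ true
  ==ᴰ-refl d = ≡ᵇ-refl (dirCode d)

  ==ᴰ-false⇒≢ : ∀ d e → (d ==ᴰ e) ≡ false → d ≢ e
  ==ᴰ-false⇒≢ d e d≠e refl with trans (sym d≠e) (==ᴰ-refl d)
  ... | ()

  ==ᴰ⇒≡ : ∀ d e → (d ==ᴰ e) ≡ true → d ≡ e
  ==ᴰ⇒≡ d e eq = begin
    d                      ≡⟨ sym (decodeDir-dirCode d) ⟩
    decodeDir (dirCode d)  ≡⟨ cong decodeDir (≡ᵇ-true⇒≡ (dirCode d) (dirCode e) eq) ⟩
    decodeDir (dirCode e)  ≡⟨ decodeDir-dirCode e ⟩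
    e                      ∎
    where open ≡-Reasoning

  allDirs : List Dir
  allDirs = N ∷ NE ∷ E ∷ SE ∷ S ∷ SW ∷ W ∷ NW ∷ []

  ∈-allDirs : ∀ d → d ∈ allDirs
  ∈-allDirs N  = here refl
  ∈-allDirs NE = there (here refl)
  ∈-allDirs E  = there (there (here refl))
  ∈-allDirs SE = there (there (there (here refl)))
  ∈-allDirs S  = there (there (there (there (here refl))))
  ∈-allDirs SW = there (there (there (there (there (here refl)))))
  ∈-allDirs W  = there (there (there (there (there (there (here refl))))))
  ∈-allDirs NW = there (there (there (there (there (there (there (here refl)))))))

  allDirs-unique : Unique allDirs
  allDirs-unique =
    ((λ ()) ∷ (λ ()) ∷ (λ ()) ∷ (λ ()) ∷ (λ ()) ∷ (λ ()) ∷ (λ ()) ∷ []) ∷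
    ((λ ()) ∷ (λ ()) ∷ (λ ()) ∷ (λ ()) ∷ (λ ()) ∷ (λ ()) ∷ []) ∷
    ((λ ()) ∷ (λ ()) ∷ (λ ()) ∷ (λ ()) ∷ (λ ()) ∷ []) ∷
    ((λ ()) ∷ (λ ()) ∷ (λ ()) ∷ (λ ()) ∷ []) ∷
    ((λ ()) ∷ (λ ()) ∷ (λ ()) ∷ []) ∷
    ((λ ()) ∷ (λ ()) ∷ []) ∷
    ((λ ()) ∷ []) ∷
    [] ∷ []

  count-==ᴰ : ∀ X → count (_==ᴰ X) allDirs ≡ 1
  count-==ᴰ N  = refl
  count-==ᴰ NE = refl
  count-==ᴰ E  = refl
  count-==ᴰ SE = refl
  count-==ᴰ S  = refl
  count-==ᴰ SW = refl
  count-==ᴰ W  = refl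
  count-==ᴰ NW = refl

  count-≠ᴰ : ∀ X → count (λ d → not (d ==ᴰ X)) allDirs ≡ 7
  count-≠ᴰ N  = refl
  count-≠ᴰ NE = refl
  count-≠ᴰ E  = refl
  count-≠ᴰ SE = refl
  count-≠ᴰ S  = refl
  count-≠ᴰ SW = refl
  count-≠ᴰ W  = refl
  count-≠ᴰ NW = refl

  -- Opaque, so that the type checker never starts enumerating 8^(n²) boards.
  opaque
    boards : ∀ n → List (Board n)
    boards n = vectors n (vectors n allDirs)

    boards≡vectors : ∀ n → boards n ≡ vectors n (vectors n allDirs)
    boards≡vectors n = refl

  ∈-boards : ∀ {n} (A : Board n) → A ∈ boards n
  ∈-boards {n} A = subst (A ∈_) (sym (boards≡vectors n)) (∈-vectors n (∈-vectors n ∈-allDirs) A)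

  boards-unique : ∀ n → Unique (boards n)
  boards-unique n = subst Unique (sym (boards≡vectors n)) (vectors-unique n (vectors-unique n allDirs-unique))

  -- Transposition

  mirror : Dir → Dir
  mirror N  = W
  mirror NE = SW
  mirror E  = S
  mirror SE = SE
  mirror S  = E
  mirror SW = NE
  mirror W  = N
  mirror NW = NW

  mirror-involutive : ∀ d → mirror (mirror d) ≡ d
  mirror-involutive N  = refl
  mirror-involutive NE = refl
  mirror-involutive E  = refl
  mirror-involutive SE = refl
  mirror-involutive S  = refl
  mirror-involutive SW = refl
  mirror-involutive W  = refl
  mirror-involutive NW = refl

  DirectsTo-mirror : ∀ d i j i′ j′ → DirectsTo d i j i′ j′ → DirectsTo (mirror d) j i j′ i′
  DirectsTo-mirror N  i j i′ j′ (j≡ , i<)       = j≡ , i<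
  DirectsTo-mirror NE i j i′ j′ (i< , j< , eq) = j< , i< , sym eq
  DirectsTo-mirror E  i j i′ j′ (i≡ , j<)       = i≡ , j<
  DirectsTo-mirror SE i j i′ j′ (i< , j< , eq) = j< , i< , sym eq
  DirectsTo-mirror S  i j i′ j′ (j≡ , i<)       = j≡ , i<
  DirectsTo-mirror SW i j i′ j′ (i< , j< , eq) = j< , i< , sym eq
  DirectsTo-mirror W  i j i′ j′ (i≡ , j<)       = i≡ , j<
  DirectsTo-mirror NW i j i′ j′ (i< , j< , eq) = j< , i< , sym eq

  transposeBoard : ∀ {n} → Board n → Board n
  transposeBoard A = Vec.tabulate λ i → Vec.tabulate λ j → mirror (entry A (j , i))

  swap : ∀ {n} → Pos n → Pos n
  swap (i , j) = j , i

  entry-transposeBoard : ∀ {n} (A : Board n) p → entry (transposeBoard A) p ≡ mirror (entry A (swap p))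
  entry-transposeBoard A (i , j)
    rewrite lookup∘tabulate (λ i → Vec.tabulate λ j → mirror (entry A (j , i))) i =
    lookup∘tabulate (λ j → mirror (entry A (j , i))) j

  transposeBoard-involutive : ∀ {n} (A : Board n) → transposeBoard (transposeBoard A) ≡ A
  transposeBoard-involutive A = begin
    transposeBoard (transposeBoard A)
      ≡⟨ tabulate-cong (λ i → tabulate-cong (λ j →
           trans (cong mirror (entry-transposeBoard A (j , i))) (mirror-involutive _))) ⟩
    Vec.tabulate (λ i → Vec.tabulate (lookup (lookup A i)))
      ≡⟨ tabulate-cong (λ i → tabulate∘lookup (lookup A i)) ⟩
    Vec.tabulate (lookup A)
      ≡⟨ tabulate∘lookup A ⟩
    A ∎
    where open ≡-Reasoning

  Move-transposeBoard : ∀ {n} (A : Board n) p q → Move A p q → Move (transposeBoard A) (swap p) (swap q)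
  Move-transposeBoard A (i , j) (i′ , j′) move =
    subst (λ d → DirectsTo d (toℕ j) (toℕ i) (toℕ j′) (toℕ i′)) (sym (entry-transposeBoard A (j , i)))
          (DirectsTo-mirror _ _ _ _ _ move)

  Path-transposeBoard : ∀ {n} (A : Board n) {k p q} → Path A k p q →
                        Path (transposeBoard A) k (swap p) (swap q)
  Path-transposeBoard A stop                      = stop
  Path-transposeBoard A (step {p = p} {q} move r) =
    step (Move-transposeBoard A p q move) (Path-transposeBoard A r)

  SolvesIn-transposeBoard : ∀ {n} (A : Board n) {k} → SolvesIn A k → SolvesIn (transposeBoard A) k
  SolvesIn-transposeBoard A (p , q , (i≡0 , j≡0) , (i≡c , j≡c) , r) =
    swap p , swap q , (j≡0 , i≡0) , (j≡c , i≡c) , Path-transposeBoard A r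

  SolvesIn-transposeBoard⁻ : ∀ {n} (A : Board n) {k} → SolvesIn (transposeBoard A) k → SolvesIn A k
  SolvesIn-transposeBoard⁻ A {k} solves =
    subst (λ B → SolvesIn B k) (transposeBoard-involutive A) (SolvesIn-transposeBoard (transposeBoard A) solves)

  IsLength-transposeBoard : ∀ {n} (A : Board n) {ℓ} → IsLength A ℓ → IsLength (transposeBoard A) ℓ
  IsLength-transposeBoard A (solves , minimal) =
    SolvesIn-transposeBoard A solves , λ k k<ℓ solvesᵀ → minimal k k<ℓ (SolvesIn-transposeBoard⁻ A solvesᵀ)

  IsLength-unique : ∀ {n} (A : Board n) {a b} → IsLength A a → IsLength A b → a ≡ b
  IsLength-unique A {a} {b} (solves-a , minimal-a) (solves-b , minimal-b) with <-cmp a b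
  ... | tri< a<b _ _ = ⊥-elim (minimal-b a a<b solves-a)
  ... | tri≈ _ a≡b _ = a≡b
  ... | tri> _ _ b<a = ⊥-elim (minimal-a b b<a solves-b)

  -- Minimal solutions visit every position at most once

  module _ {n : ℕ} {A : Board n} where

    open DecMembership (≡-dec (Fin._≟_ {n}) (Fin._≟_ {n})) using (_∈?_)

    visited : ∀ {k p q} → Path A k p q → List (Pos n)
    visited (stop {p = p})     = p ∷ []
    visited (step {p = p} _ r) = p ∷ visited r

    visited-length : ∀ {k p q} (r : Path A k p q) → length (visited r) ≡ suc k
    visited-length stop       = refl
    visited-length (step _ r) = cong suc (visited-length r)

    ShortSimplePath : ℕ → Pos n → Pos n → Set
    ShortSimplePath k p q = Σ ℕ λ k′ → k′ ≤ k × Σ (Path A k′ p q) λ r → Unique (visited r)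

    suffix : ∀ {k p q x} (r : Path A k p q) → Unique (visited r) → x ∈ visited r → ShortSimplePath k x q
    suffix stop                     u        (here refl) = 0 , z≤n , stop , [] ∷ []
    suffix (step {k = k} move r)    u        (here refl) = suc k , ≤-refl , step move r , u
    suffix (step move r)            (_ ∷ u)  (there x∈) with suffix r u x∈
    ... | k′ , k′≤k , r′ , u′ = k′ , m≤n⇒m≤1+n k′≤k , r′ , u′

    simplify : ∀ {k p q} → Path A k p q → ShortSimplePath k p q
    simplify stop = 0 , z≤n , stop , [] ∷ []
    simplify (step {p = p} move r) with simplify r
    ... | k′ , k′≤k , r′ , u′ with p ∈? visited r′
    ...   | yes p∈ with suffix r′ u′ p∈
    ...     | k″ , k″≤k′ , r″ , u″ = k″ , m≤n⇒m≤1+n (≤-trans k″≤k′ k′≤k) , r″ , u″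
    simplify (step {p = p} move r) | k′ , k′≤k , r′ , u′ | no p∉ =
      suc k′ , s≤s k′≤k , step move r′ , ¬Any⇒All¬ (visited r′) p∉ ∷ u′

  positions : ∀ n → List (Pos n)
  positions n = cartesianProductWith _,_ (allFin n) (allFin n)

  unique-positions-≤ : ∀ {n} (xs : List (Pos n)) → Unique xs → length xs ≤ n * n
  unique-positions-≤ {n} xs u = begin
    length xs                           ≡⟨ count-true xs ⟨
    count (λ _ → true) xs               ≤⟨ count-mono _ xs (positions n) u (λ (i , j) _ _ →
                                             ∈-cartesianProductWith⁺ _,_ (∈-allFin i) (∈-allFin j)) ⟩
    count (λ _ → true) (positions n)    ≡⟨ count-cartesianProductWith _,_ _ _ _ (allFin n) (allFin n) (λ _ _ → refl) ⟩
    count (λ _ → true) (allFin n) * count (λ _ → true) (allFin n)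
                                        ≡⟨ cong (λ m → m * m) (trans (count-true (allFin n)) (length-tabulate {n = n} id)) ⟩
    n * n                               ∎
    where open ≤-Reasoning

  IsLength-< : ∀ {n} (A : Board n) {ℓ} → IsLength A ℓ → ℓ < n * n
  IsLength-< {n} A {ℓ} ((p , q , start , centre , r) , minimal) with simplify r
  ... | k , k≤ℓ , r′ , u with k <? ℓ
  ...   | yes k<ℓ = ⊥-elim (minimal k k<ℓ (p , q , start , centre , r′))
  ...   | no  k≮ℓ = begin-strict
    ℓ                   <⟨ s≤s (≮⇒≥ k≮ℓ) ⟩
    suc k               ≡⟨ visited-length r′ ⟨
    length (visited r′) ≤⟨ unique-positions-≤ (visited r′) u ⟩
    n * n               ∎
    where open ≤-Reasoning




  -- Moves from the corner and into the centre

  moves-from-origin : ∀ d i j → DirectsTo d 0 0 i j → d ≡ SE ⊎ d ≡ S ⊎ d ≡ E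
  moves-from-origin N  i j (_ , ())
  moves-from-origin NE i j (() , _)
  moves-from-origin E  i j _         = inj₂ (inj₂ refl)
  moves-from-origin SE i j _         = inj₁ refl
  moves-from-origin S  i j _         = inj₂ (inj₁ refl)
  moves-from-origin SW i j (_ , () , _)
  moves-from-origin W  i j (_ , ())
  moves-from-origin NW i j (() , _)

  moves-from-first-column : ∀ d i c → 0 < i → 0 < c → DirectsTo d i 0 c c →
                            (d ≡ E × i ≡ c) ⊎ (d ≡ NE × i ≡ c + c)
  moves-from-first-column N  i c _   0<c (c≡0 , _) = ⊥-elim (<⇒≢ 0<c (sym c≡0))
  moves-from-first-column NE i c _   _   (c<i , _ , i∸c≡c) =
    inj₂ (refl , trans (sym (m∸n+n≡m (<⇒≤ c<i))) (cong (_+ c) i∸c≡c))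
  moves-from-first-column E  i c _   _   (c≡i , _) = inj₁ (refl , sym c≡i)
  moves-from-first-column SE i c 0<i _   (i<c , _ , c∸i≡c) = ⊥-elim (<⇒≢ 0<i (sym i≡0))
    where
    i≡0 : i ≡ 0
    i≡0 = +-cancelˡ-≡ c i 0 (begin
      c + i        ≡⟨ +-comm c i ⟩
      i + c        ≡⟨ cong (i +_) c∸i≡c ⟨
      i + (c ∸ i)  ≡⟨ m+[n∸m]≡n (<⇒≤ i<c) ⟩
      c            ≡⟨ +-identityʳ c ⟨
      c + 0        ∎)
      where open ≡-Reasoning
  moves-from-first-column S  i c _   0<c (c≡0 , _) = ⊥-elim (<⇒≢ 0<c (sym c≡0))
  moves-from-first-column SW i c _   _   (_ , () , _)
  moves-from-first-column W  i c _   _   (_ , ())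
  moves-from-first-column NW i c _   _   (_ , () , _)

  3+m+m≡1+[1+m]*2 : ∀ m → suc (suc (suc (m + m))) ≡ 1 + suc m * 2
  3+m+m≡1+[1+m]*2 = solve-∀

  *-pos : ∀ m n → 0 < m → 0 < n → 0 < m * n
  *-pos m n 0<m 0<n = *-mono-< 0<m 0<n

  *-^-distrib : ∀ m n k → (m * n) ^ k ≡ m ^ k * n ^ k
  *-^-distrib m n zero    = refl
  *-^-distrib m n (suc k) = trans (cong (m * n *_) (*-^-distrib m n k)) (interchange m n (m ^ k) (n ^ k))
    where
    interchange : ∀ a b c d → a * b * (c * d) ≡ a * c * (b * d)
    interchange = solve-∀

  cube : ℕ → ℕ
  cube x = x * x * x

  64*cube≥63*cube-next : ∀ k → 64 * ((k + 190) * (k + 190) * (k + 190)) ≡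
    63 * ((suc k + 190) * (suc k + 190) * (suc k + 190)) + (k * k * k + 381 * (k * k) + 36291 * k + 127)
  64*cube≥63*cube-next = solve-∀

  *-rotate : ∀ a b c → a * b * c ≡ b * (a * c)
  *-rotate = solve-∀

  -- (1 + 1/63)^k ≥ (1 + k/190)^3, by induction: the step is 64 (k+190)^3 ≥ 63 (k+191)^3.
  63^k*cube≤190^3*64^k : ∀ k → 63 ^ k * cube (k + 190) ≤ 6859000 * 64 ^ k
  63^k*cube≤190^3*64^k zero    = ≤-refl
  63^k*cube≤190^3*64^k (suc k) = begin
    63 * 63 ^ k * cube (suc k + 190)   ≡⟨ *-rotate 63 (63 ^ k) (cube (suc k + 190)) ⟩
    63 ^ k * (63 * cube (suc k + 190)) ≤⟨ *-monoʳ-≤ (63 ^ k) (≤-trans (m≤m+n _ _) (≤-reflexive (sym (64*cube≥63*cube-next k)))) ⟩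
    63 ^ k * (64 * cube (k + 190))     ≡⟨ *-rotate 64 (63 ^ k) (cube (k + 190)) ⟨
    64 * 63 ^ k * cube (k + 190)       ≡⟨ *-assoc 64 (63 ^ k) _ ⟩
    64 * (63 ^ k * cube (k + 190))     ≤⟨ *-monoʳ-≤ 64 (63^k*cube≤190^3*64^k k) ⟩
    64 * (6859000 * 64 ^ k)            ≡⟨ *-rotate 6859000 64 (64 ^ k) ⟨
    6859000 * 64 * 64 ^ k              ≡⟨ *-assoc 6859000 64 (64 ^ k) ⟩
    6859000 * (64 * 64 ^ k)            ∎
    where open ≤-Reasoning



  3+m+m≤2[m+190] : ∀ m → suc (suc (suc (m + m))) ≤ 2 * (m + 190)
  3+m+m≤2[m+190] m = begin
    suc (suc (suc (m + m))) ≡⟨ 3+m+m≡2m+3 m ⟩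
    2 * m + 3               ≤⟨ +-monoʳ-≤ (2 * m) (s≤s (s≤s (s≤s z≤n))) ⟩
    2 * m + 380             ≡⟨ 2m+380≡2[m+190] m ⟩
    2 * (m + 190)           ∎
    where
    open ≤-Reasoning
    3+m+m≡2m+3 : ∀ m → suc (suc (suc (m + m))) ≡ 2 * m + 3
    3+m+m≡2m+3 = solve-∀
    2m+380≡2[m+190] : ∀ m → 2 * m + 380 ≡ 2 * (m + 190)
    2m+380≡2[m+190] = solve-∀


  -- Opaque, so that the type checker never unfolds the numeral 6859000 into successors.
  opaque
    threshold : ℕ → ℕ
    threshold d = 1176 * d * 6859000

    threshold≡ : ∀ d → threshold d ≡ 1176 * d * 6859000
    threshold≡ d = refl

  63^t-negligible : ∀ t d → threshold d ≤ t →
    294 * (suc (suc (suc (t + t))) * suc (suc (suc (t + t)))) * d * 63 ^ t < 64 * 64 ^ t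
  63^t-negligible t d t-large = *-cancelʳ-< c _ _ (begin-strict
    294 * (n * n) * d * 63 ^ t * c
      ≤⟨ *-monoˡ-≤ c (*-monoˡ-≤ (63 ^ t) (*-monoˡ-≤ d (*-monoʳ-≤ 294 (*-mono-≤ n≤2c n≤2c)))) ⟩
    294 * ((2 * c) * (2 * c)) * d * 63 ^ t * c
      ≡⟨ regroup-square c d (63 ^ t) ⟩
    1176 * d * (63 ^ t * cube c)
      ≤⟨ *-monoʳ-≤ (1176 * d) (63^k*cube≤190^3*64^k t) ⟩
    1176 * d * (6859000 * 64 ^ t)
      ≡⟨ *-assoc (1176 * d) 6859000 (64 ^ t) ⟨
    1176 * d * 6859000 * 64 ^ t
      ≤⟨ *-monoˡ-≤ (64 ^ t) (subst (_≤ t) (threshold≡ d) t-large) ⟩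
    t * 64 ^ t
      <⟨ *-monoˡ-< (64 ^ t) {{m^n≢0 64 t}} t<64c ⟩
    64 * c * 64 ^ t
      ≡⟨ *-rotate 64 c (64 ^ t) ⟩
    c * (64 * 64 ^ t)
      ≡⟨ *-comm c (64 * 64 ^ t) ⟩
    64 * 64 ^ t * c ∎)
    where
    open ≤-Reasoning
    n c : ℕ
    n = suc (suc (suc (t + t)))
    c = t + 190
    n≤2c : n ≤ 2 * c
    n≤2c = 3+m+m≤2[m+190] t
    t<64c : t < 64 * c
    t<64c = ≤-trans (≤-trans (s≤s (m≤m+n t 189)) (≤-reflexive (sym (+-suc t 189)))) (m≤m+n c (63 * c))
    regroup-square : ∀ c d p → 294 * ((2 * c) * (2 * c)) * d * p * c ≡ 1176 * d * (p * (c * c * c))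
    regroup-square = solve-∀











  -- K is compared with Z through the common factor b (= 64^t) on both sides.
  rare-class-bound : ∀ q d K Z a b → 0 < Z → K * b ≡ 49 * a * Z → 294 * q * d * a < 64 * b →
                     576 * q * K * d < 6144 * Z
  rare-class-bound q d K Z a b Z>0 Kb≡49aZ small = *-cancelʳ-< b _ _ (begin-strict
    576 * q * K * d * b           ≡⟨ 576qKdb≡576qd[Kb] q K d b ⟩
    576 * q * d * (K * b)         ≡⟨ cong (576 * q * d *_) Kb≡49aZ ⟩
    576 * q * d * (49 * a * Z)    ≡⟨ 96[294qda]Z≡576qd[49aZ] q d a Z ⟨
    96 * (294 * q * d * a) * Z    <⟨ *-monoˡ-< Z {{>-nonZero Z>0}} (*-monoʳ-< 96 small) ⟩
    96 * (64 * b) * Z             ≡⟨ 96[64b]Z≡6144Zb b Z ⟩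
    6144 * Z * b                  ∎)
    where
    open ≤-Reasoning
    576qKdb≡576qd[Kb] : ∀ q K d b → 576 * q * K * d * b ≡ 576 * q * d * (K * b)
    576qKdb≡576qd[Kb] = solve-∀
    96[294qda]Z≡576qd[49aZ] : ∀ q d a z → 96 * (294 * q * d * a) * z ≡ 576 * q * d * (49 * a * z)
    96[294qda]Z≡576qd[49aZ] = solve-∀
    96[64b]Z≡6144Zb : ∀ b z → 96 * (64 * b) * z ≡ 6144 * z * b
    96[64b]Z≡6144Zb = solve-∀

  -- Comparing a mean with 209/96

  -- |m - n| ≤ M, stated without truncated subtraction.
  Within : ℕ → ℕ → ℕ → Set
  Within M m n = Σ ℕ λ d⁺ → Σ ℕ λ d⁻ → m + d⁻ ≡ n + d⁺ × d⁺ ≤ M × d⁻ ≤ M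

  Within⇒∣⊖∣≤ : ∀ {M m n} → Within M m n → ℤ.∣ m ⊖ n ∣ ≤ M
  Within⇒∣⊖∣≤ {M} {m} {n} (d⁺ , d⁻ , m+d⁻≡n+d⁺ , d⁺≤M , d⁻≤M) = begin
    ℤ.∣ m ⊖ n ∣                  ≡⟨ cong ℤ.∣_∣ (ℤ.+-cancelˡ-⊖ d⁻ m n) ⟨
    ℤ.∣ (d⁻ + m) ⊖ (d⁻ + n) ∣    ≡⟨ cong₂ (λ a b → ℤ.∣ a ⊖ b ∣) (trans (+-comm d⁻ m) m+d⁻≡n+d⁺) (+-comm d⁻ n) ⟩
    ℤ.∣ (n + d⁺) ⊖ (n + d⁻) ∣    ≡⟨ cong ℤ.∣_∣ (ℤ.+-cancelˡ-⊖ n d⁺ d⁻) ⟩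
    ℤ.∣ d⁺ ⊖ d⁻ ∣                ≤⟨ ℤ.∣m⊝n∣≤m⊔n d⁺ d⁻ ⟩
    d⁺ ⊔ d⁻                      ≤⟨ ⊔-lub d⁺≤M d⁻≤M ⟩
    M                            ∎
    where open ≤-Reasoning

  -- With B = suc b and L′ = suc L: |s/L′ - a/B| = |B s - a L′| / (B L′) ≤ M / (B L′) < 1/den ε ≤ ε.
  Within⇒ratio-close : ∀ s L a b M (ε : ℚ) → 0ℚ ℚ.< ε → Within M (suc b * s) (a * suc L) →
    M * suc (ℚ.denominator-1 ε) < suc b * suc L → ℚ.∣ (ℤ.+ s) ℚ./ suc L ℚ.- (ℤ.+ a) ℚ./ suc b ∣ ℚ.< ε
  Within⇒ratio-close s L a b M (mkℚ (ℤ.+ zero)   _ _) (ℚ.*<* (ℤ.+<+ ())) _ _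
  Within⇒ratio-close s L a b M (mkℚ -[1+ _ ]   _ _) (ℚ.*<* ())         _ _
  Within⇒ratio-close s L a b M ε@(mkℚ (ℤ.+ suc k) d _) _ within M*d<bL =
    ℚ.toℚᵘ-cancel-< (subst (ℚᵘ._< ℚ.toℚᵘ ε) (∣toℚᵘ∣ difference)
                           (ℚᵘ.<-respˡ-≃ (ℚᵘ.∣-∣-cong (ℚᵘ.≃-sym toℚᵘ-difference)) core))
    where
    difference : ℚ
    difference = (ℤ.+ s) ℚ./ suc L ℚ.- (ℤ.+ a) ℚ./ suc b
    ∣toℚᵘ∣ : ∀ x → ℚᵘ.∣ ℚ.toℚᵘ x ∣ ≡ ℚ.toℚᵘ (ℚ.∣ x ∣)
    ∣toℚᵘ∣ (mkℚ _ _ _) = refl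
    toℚᵘ-difference : ℚ.toℚᵘ difference ℚᵘ.≃ (ℚᵘ.mkℚᵘ (ℤ.+ s) L ℚᵘ.- ℚᵘ.mkℚᵘ (ℤ.+ a) b)
    toℚᵘ-difference = ℚᵘ.≃-trans (ℚ.toℚᵘ-homo-+ ((ℤ.+ s) ℚ./ suc L) (ℚ.- ((ℤ.+ a) ℚ./ suc b)))
      (ℚᵘ.+-cong (ℚ.toℚᵘ-fromℚᵘ (ℚᵘ.mkℚᵘ (ℤ.+ s) L))
                 (ℚᵘ.≃-trans (ℚ.toℚᵘ-homo‿- ((ℤ.+ a) ℚ./ suc b)) (ℚᵘ.-‿cong (ℚ.toℚᵘ-fromℚᵘ (ℚᵘ.mkℚᵘ (ℤ.+ a) b)))))
    numerator : ℤ
    numerator = (ℤ.+ s) ℤ.* (ℤ.+ suc b) ℤ.+ (ℤ.- (ℤ.+ a)) ℤ.* (ℤ.+ suc L)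
    numerator≡ : numerator ≡ (suc b * s) ⊖ (a * suc L)
    numerator≡ = begin-equality
      (ℤ.+ s) ℤ.* (ℤ.+ suc b) ℤ.+ (ℤ.- (ℤ.+ a)) ℤ.* (ℤ.+ suc L)
        ≡⟨ cong₂ ℤ._+_ (trans (sym (ℤ.pos-* s (suc b))) (cong ℤ.+_ (*-comm s (suc b))))
                       (trans (sym (ℤ.neg-distribˡ-* (ℤ.+ a) (ℤ.+ suc L))) (cong ℤ.-_ (sym (ℤ.pos-* a (suc L))))) ⟩
      (ℤ.+ (suc b * s)) ℤ.- (ℤ.+ (a * suc L))
        ≡⟨ ℤ.m-n≡m⊖n (suc b * s) (a * suc L) ⟩
      (suc b * s) ⊖ (a * suc L) ∎
      where open ℤ.≤-Reasoning
    core : ℚᵘ.∣ ℚᵘ.mkℚᵘ (ℤ.+ s) L ℚᵘ.- ℚᵘ.mkℚᵘ (ℤ.+ a) b ∣ ℚᵘ.< ℚ.toℚᵘ ε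
    core = ℚᵘ.*<* (subst₂ ℤ._<_ (ℤ.pos-* ℤ.∣ numerator ∣ (suc d)) (ℤ.pos-* (suc k) (suc L * suc b)) (ℤ.+<+ (begin-strict
      ℤ.∣ numerator ∣ * suc d   ≤⟨ *-monoˡ-≤ (suc d) (subst (λ x → ℤ.∣ x ∣ ≤ M) (sym numerator≡) (Within⇒∣⊖∣≤ within)) ⟩
      M * suc d                 <⟨ M*d<bL ⟩
      suc b * suc L             ≡⟨ *-comm (suc b) (suc L) ⟩
      suc L * suc b             ≤⟨ m≤m+n (suc L * suc b) (k * (suc L * suc b)) ⟩
      suc k * (suc L * suc b)   ∎)))
      where open ≤-Reasoning





  branch-balance-identity : ∀ z k x y c σ → x ≡ 15 * z → y + k ≡ 49 * z →
    96 * (2 * x + (3 * y + σ)) + (79 * k + 209 * c) ≡ 209 * (x + (y + c)) + (3616 * z + 96 * σ)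
  branch-balance-identity z k .(15 * z) y c σ refl y+k≡49z =
    +-cancelʳ-≡ (79 * (49 * z)) (96 * (2 * (15 * z) + (3 * y + σ)) + (79 * k + 209 * c))
                                (209 * (15 * z + (y + c)) + (3616 * z + 96 * σ))
      (trans (branch-identity z k y c σ) (cong (λ m → 209 * (15 * z + (y + c)) + (3616 * z + 96 * σ) + 79 * m) y+k≡49z))
    where
    branch-identity : ∀ z k y c σ →
      96 * (2 * (15 * z) + (3 * y + σ)) + (79 * k + 209 * c) + 79 * (49 * z) ≡
      209 * (15 * z + (y + c)) + (3616 * z + 96 * σ) + 79 * (y + k)
    branch-identity = solve-∀





  -- One of the two symmetric branches (corner S, or corner E): boards of total length s, l of them.
  -- Its mean is close to 177/64, and 96 * 177 - 209 * 64 = 3616 is the surplus that the corner-SE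
  -- boards (mean 1) must compensate: (209 - 96) * 64 = 2 * 3616.
  BranchBalance : (Z K q s l : ℕ) → Set
  BranchBalance Z K q s l =
    Σ ℕ λ e → Σ ℕ λ f → 96 * s + e ≡ 209 * l + (3616 * Z + f) × e ≤ 288 * K × f ≤ 96 * q * K

  branch-balance : ∀ Z K q x y c σ → x + 49 * Z ≡ 64 * Z → y + K ≡ 49 * Z → c ≤ K → σ ≤ q * c →
                   BranchBalance Z K q (2 * x + (3 * y + σ)) (x + (y + c))
  branch-balance Z K q x y c σ x+49Z≡64Z y+K≡49Z c≤K σ≤qc = 79 * K + 209 * c , 96 * σ , balance , e≤ , f≤
    where
    x≡15Z : x ≡ 15 * Z
    x≡15Z = +-cancelʳ-≡ (49 * Z) x (15 * Z) (trans x+49Z≡64Z (64Z≡15Z+49Z Z))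
      where
      64Z≡15Z+49Z : ∀ z → 64 * z ≡ 15 * z + 49 * z
      64Z≡15Z+49Z = solve-∀
    balance : 96 * (2 * x + (3 * y + σ)) + (79 * K + 209 * c) ≡ 209 * (x + (y + c)) + (3616 * Z + 96 * σ)
    balance = branch-balance-identity Z K x y c σ x≡15Z y+K≡49Z
    e≤ : 79 * K + 209 * c ≤ 288 * K
    e≤ = ≤-trans (+-monoʳ-≤ (79 * K) (*-monoʳ-≤ 209 c≤K)) (≤-reflexive (sym (*-distribʳ-+ K 79 209)))
    f≤ : 96 * σ ≤ 96 * q * K
    f≤ = ≤-trans (*-monoʳ-≤ 96 (≤-trans σ≤qc (*-monoʳ-≤ q c≤K))) (≤-reflexive (sym (*-assoc 96 q K)))

  combine-balances : ∀ Z K q s₁ l₁ s₂ l₂ → 1 ≤ q → BranchBalance Z K q s₁ l₁ → BranchBalance Z K q s₂ l₂ →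
                     Within (576 * q * K) (96 * (64 * Z + s₁ + s₂)) (209 * (64 * Z + l₁ + l₂))
  combine-balances Z K q s₁ l₁ s₂ l₂ 1≤q (e₁ , f₁ , bal₁ , e₁≤ , f₁≤) (e₂ , f₂ , bal₂ , e₂≤ , f₂≤) =
    f₁ + f₂ , e₁ + e₂ , balance , f≤ , e≤
    where
    combine-identity₁ : ∀ z s₁ s₂ e₁ e₂ →
      96 * (64 * z + s₁ + s₂) + (e₁ + e₂) ≡ 6144 * z + (96 * s₁ + e₁) + (96 * s₂ + e₂)
    combine-identity₁ = solve-∀
    combine-identity₂ : ∀ z l₁ l₂ f₁ f₂ →
      6144 * z + (209 * l₁ + (3616 * z + f₁)) + (209 * l₂ + (3616 * z + f₂)) ≡ 209 * (64 * z + l₁ + l₂) + (f₁ + f₂)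
    combine-identity₂ = solve-∀
    96qk+96qk+384qk≡576qk : ∀ q k → 96 * q * k + 96 * q * k + 384 * q * k ≡ 576 * q * k
    96qk+96qk+384qk≡576qk = solve-∀
    288k+288k≡576*1*k : ∀ k → 288 * k + 288 * k ≡ 576 * 1 * k
    288k+288k≡576*1*k = solve-∀
    balance : 96 * (64 * Z + s₁ + s₂) + (e₁ + e₂) ≡ 209 * (64 * Z + l₁ + l₂) + (f₁ + f₂)
    balance = trans (combine-identity₁ Z s₁ s₂ e₁ e₂)
                    (trans (cong₂ (λ a b → 6144 * Z + a + b) bal₁ bal₂) (combine-identity₂ Z l₁ l₂ f₁ f₂))
    f≤ : f₁ + f₂ ≤ 576 * q * K
    f≤ = ≤-trans (+-mono-≤ f₁≤ f₂≤) (≤-trans (m≤m+n _ (384 * q * K)) (≤-reflexive (96qk+96qk+384qk≡576qk q K)))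
    e≤ : e₁ + e₂ ≤ 576 * q * K
    e≤ = ≤-trans (+-mono-≤ e₁≤ e₂≤)
                 (≤-trans (≤-reflexive (288k+288k≡576*1*k K)) (*-monoˡ-≤ K (*-monoʳ-≤ 576 1≤q)))

  -- Boards of odd size 2t + 3, with 0-based centre index t + 1; rows and columns split into the
  -- blocks {0}, [1, t], {t + 1}, [t + 2, 2t + 1], {2t + 2}.
  module Family (t : ℕ) where

    size centre bottom : ℕ
    size   = suc (suc (suc (t + t)))
    centre = suc t
    bottom = suc (suc (t + t))

    centre<size : centre < size
    centre<size = s≤s (s≤s (≤-trans (m≤m+n t t) (n≤1+n _)))

    size≡blocks : size ≡ suc (t + suc (t + 1))
    size≡blocks = 3+m+m≡1+m+1+m+1 t
      where
      3+m+m≡1+m+1+m+1 : ∀ m → suc (suc (suc (m + m))) ≡ suc (m + suc (m + 1))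
      3+m+m≡1+m+1+m+1 = solve-∀

    size/2≡centre : size / 2 ≡ centre
    size/2≡centre = begin
      size / 2               ≡⟨ /-congˡ {o = 2} (3+m+m≡1+[1+m]*2 t) ⟩
      (1 + centre * 2) / 2   ≡⟨ +-distrib-/-∣ʳ 1 {d = 2} (divides centre refl) ⟩
      centre * 2 / 2         ≡⟨ m*n/n≡m centre 2 ⟩
      centre                 ∎
      where open ≡-Reasoning

    block-cases : ∀ {i} → i < size →
      i ≡ 0 ⊎ (0 < i × i < centre) ⊎ i ≡ centre ⊎ (centre < i × i < bottom) ⊎ i ≡ bottom
    block-cases {zero}  _ = inj₁ refl
    block-cases {suc i} i<size with <-cmp (suc i) centre
    ... | tri< i<c _ _ = inj₂ (inj₁ (s≤s z≤n , i<c))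
    ... | tri≈ _ i≡c _ = inj₂ (inj₂ (inj₁ i≡c))
    ... | tri> _ _ c<i with <-cmp (suc i) bottom
    ...   | tri< i<b _ _ = inj₂ (inj₂ (inj₂ (inj₁ (c<i , i<b))))
    ...   | tri≈ _ i≡b _ = inj₂ (inj₂ (inj₂ (inj₂ i≡b)))
    ...   | tri> _ _ b<i = ⊥-elim (<⇒≱ i<size b<i)

    module _ {A : Set} (P₀ Pᵤ P꜀ Pₗ Pₙ : A → Bool) where

      blockPred : ℕ → A → Bool
      blockPred i = if i ≡ᵇ 0 then P₀ else if i <ᵇ centre then Pᵤ else
                    if i ≡ᵇ centre then P꜀ else if i <ᵇ bottom then Pₗ else Pₙ

      blockwise : Vec A size → Bool
      blockwise = allFrom blockPred 0

      blockPred-upper : ∀ {i} → 0 < i → i < centre → blockPred i ≡ Pᵤ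
      blockPred-upper {suc i} _ i<c rewrite <⇒<ᵇ-true i<c = refl

      blockPred-centre : blockPred centre ≡ P꜀
      blockPred-centre rewrite ≥⇒<ᵇ-false (≤-refl {centre}) | ≡ᵇ-refl centre = refl

      blockPred-lower : ∀ {i} → centre < i → i < bottom → blockPred i ≡ Pₗ
      blockPred-lower {suc i} c<i i<b
        rewrite ≥⇒<ᵇ-false (<⇒≤ c<i) | ≢⇒≡ᵇ-false (>⇒≢ c<i) | <⇒<ᵇ-true i<b = refl

      blockPred-bottom : blockPred bottom ≡ Pₙ
      blockPred-bottom
        rewrite ≥⇒<ᵇ-false (<⇒≤ (s≤s (s≤s (m≤m+n t t))) ) | ≢⇒≡ᵇ-false (>⇒≢ (s≤s (s≤s (m≤m+n t t))))
              | ≥⇒<ᵇ-false (≤-refl {bottom}) = refl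

      count-blockwise : ∀ xs → count blockwise (vectors size xs) ≡
        count P₀ xs * (count Pᵤ xs ^ t * (count P꜀ xs * (count Pₗ xs ^ t * count Pₙ xs)))
      count-blockwise xs = begin
        count blockwise (vectors size xs)
          ≡⟨ count-allFrom-vectors size blockPred 0 xs ⟩
        productFrom f 0 size
          ≡⟨ cong (productFrom f 0) size≡blocks ⟩
        f 0 * productFrom f 1 (t + suc (t + 1))
          ≡⟨ cong (f 0 *_) (productFrom-+ f 1 t (suc (t + 1))) ⟩
        f 0 * (productFrom f 1 t * (f centre * productFrom f (suc centre) (t + 1)))
          ≡⟨ cong (λ m → f 0 * (productFrom f 1 t * (f centre * m))) (productFrom-+ f (suc centre) t 1) ⟩
        f 0 * (productFrom f 1 t * (f centre * (productFrom f (suc centre) t * (f bottom * 1))))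
          ≡⟨ cong₂ (λ u l → f 0 * (u * (f centre * (l * (f bottom * 1)))))
                   (productFrom-const f _ 1 t (λ i 0<i i<c → cong (λ P → count P xs) (blockPred-upper 0<i i<c)))
                   (productFrom-const f _ (suc centre) t (λ i c<i i<b → cong (λ P → count P xs) (blockPred-lower c<i i<b))) ⟩
        f 0 * (count Pᵤ xs ^ t * (f centre * (count Pₗ xs ^ t * (f bottom * 1))))
          ≡⟨ cong₂ (λ c b → f 0 * (count Pᵤ xs ^ t * (c * (count Pₗ xs ^ t * b))))
                   (cong (λ P → count P xs) blockPred-centre)
                   (trans (*-identityʳ (f bottom)) (cong (λ P → count P xs) blockPred-bottom)) ⟩
        count P₀ xs * (count Pᵤ xs ^ t * (count P꜀ xs * (count Pₗ xs ^ t * count Pₙ xs))) ∎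
        where
        open ≡-Reasoning
        f : ℕ → ℕ
        f i = count (blockPred i) xs

      blockwise-lookup : ∀ v → blockwise v ≡ true → ∀ i → blockPred (toℕ i) (lookup v i) ≡ true
      blockwise-lookup v all = allFrom-lookup blockPred 0 v all

      blockwise-first : ∀ v → blockwise v ≡ true → P₀ (lookup v Fin.zero) ≡ true
      blockwise-first v all = blockwise-lookup v all Fin.zero

      blockwise-centre : ∀ v → blockwise v ≡ true → ∀ i → toℕ i ≡ centre → P꜀ (lookup v i) ≡ true
      blockwise-centre v all i i≡c =
        subst (λ P → P (lookup v i) ≡ true) (trans (cong blockPred i≡c) blockPred-centre) (blockwise-lookup v all i)

      blockwise-bottom : ∀ v → blockwise v ≡ true → ∀ i → toℕ i ≡ bottom → Pₙ (lookup v i) ≡ true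
      blockwise-bottom v all i i≡b =
        subst (λ P → P (lookup v i) ≡ true) (trans (cong blockPred i≡b) blockPred-bottom) (blockwise-lookup v all i)

      blockwise-false : ∀ v → blockwise v ≡ false →
          P₀ (lookup v Fin.zero) ≡ false
        ⊎ Σ (Fin size) (λ i → (0 < toℕ i × toℕ i < centre) × Pᵤ (lookup v i) ≡ false)
        ⊎ Σ (Fin size) (λ i → toℕ i ≡ centre × P꜀ (lookup v i) ≡ false)
        ⊎ Σ (Fin size) (λ i → (centre < toℕ i × toℕ i < bottom) × Pₗ (lookup v i) ≡ false)
        ⊎ Σ (Fin size) (λ i → toℕ i ≡ bottom × Pₙ (lookup v i) ≡ false)
      blockwise-false v none with allFrom-false blockPred 0 v none
      ... | i , fails with block-cases (toℕ<n i)
      ... | inj₁ i≡0 rewrite toℕ-injective {i = i} {j = Fin.zero} i≡0 = inj₁ fails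
      ... | inj₂ (inj₁ (0<i , i<c)) =
        inj₂ (inj₁ (i , (0<i , i<c) , subst (λ P → P (lookup v i) ≡ false) (blockPred-upper 0<i i<c) fails))
      ... | inj₂ (inj₂ (inj₁ i≡c)) =
        inj₂ (inj₂ (inj₁ (i , i≡c , subst (λ P → P (lookup v i) ≡ false) (trans (cong blockPred i≡c) blockPred-centre) fails)))
      ... | inj₂ (inj₂ (inj₂ (inj₁ (c<i , i<b)))) =
        inj₂ (inj₂ (inj₂ (inj₁ (i , (c<i , i<b) , subst (λ P → P (lookup v i) ≡ false) (blockPred-lower c<i i<b) fails))))
      ... | inj₂ (inj₂ (inj₂ (inj₂ i≡b))) =
        inj₂ (inj₂ (inj₂ (inj₂ (i , i≡b , subst (λ P → P (lookup v i) ≡ false) (trans (cong blockPred i≡b) blockPred-bottom) fails))))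

    blockwise-mono : ∀ {A : Set} (P₀ Pᵤ P꜀ Pₗ Pₙ Q₀ Qᵤ Q꜀ Qₗ Qₙ : A → Bool) →
      (∀ x → P₀ x ≡ true → Q₀ x ≡ true) → (∀ x → Pᵤ x ≡ true → Qᵤ x ≡ true) →
      (∀ x → P꜀ x ≡ true → Q꜀ x ≡ true) → (∀ x → Pₗ x ≡ true → Qₗ x ≡ true) →
      (∀ x → Pₙ x ≡ true → Qₙ x ≡ true) →
      ∀ v → blockwise P₀ Pᵤ P꜀ Pₗ Pₙ v ≡ true → blockwise Q₀ Qᵤ Q꜀ Qₗ Qₙ v ≡ true
    blockwise-mono P₀ Pᵤ P꜀ Pₗ Pₙ Q₀ Qᵤ Q꜀ Qₗ Qₙ m₀ mᵤ m꜀ mₗ mₙ v = allFrom-mono _ _ 0 v blockPred-mono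
      where
      blockPred-mono : ∀ i x → blockPred P₀ Pᵤ P꜀ Pₗ Pₙ i x ≡ true → blockPred Q₀ Qᵤ Q꜀ Qₗ Qₙ i x ≡ true
      blockPred-mono i x with i ≡ᵇ 0
      ... | true = m₀ x
      ... | false with i <ᵇ centre
      ...   | true = mᵤ x
      ...   | false with i ≡ᵇ centre
      ...     | true = m꜀ x
      ...     | false with i <ᵇ bottom
      ...       | true  = mₗ x
      ...       | false = mₙ x

    Row : Set
    Row = Vec Dir size

    rows : List Row
    rows = vectors size allDirs

    firstIs firstIsNot : Dir → Row → Bool
    firstIs    X = blockwise (_==ᴰ X) (const true) (const true) (const true) (const true)
    firstIsNot X = blockwise (λ d → not (d ==ᴰ X)) (const true) (const true) (const true) (const true)

    eastThenSouth : Row → Bool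
    eastThenSouth = blockwise (_==ᴰ E) (const true) (_==ᴰ S) (const true) (const true)

    cornerIs : Dir → Board size → Bool
    cornerIs X = blockwise (firstIs X) (const true) (const true) (const true) (const true)

    -- From corner S the first move goes down column 0. The second move can reach the centre only
    -- by E from row t + 1 or by NE from row 2t + 2, and a third move only after E then S from a
    -- row in [1, t]; so these characterise boards with corner S of length > 2, resp. > 3.
    southNoTwo southNoThree : Board size → Bool
    southNoTwo   = blockwise (firstIs S) (const true) (firstIsNot E) (const true) (firstIsNot NE)
    southNoThree = blockwise (firstIs S) (λ r → not (eastThenSouth r)) (firstIsNot E) (const true) (firstIsNot NE)

    blockwise-first-false : ∀ {A : Set} (P : A → Bool) v →
      blockwise P (const true) (const true) (const true) (const true) v ≡ false → P (lookup v Fin.zero) ≡ false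
    blockwise-first-false P v none with blockwise-false P _ _ _ _ v none
    ... | inj₁ fails = fails
    ... | inj₂ (inj₁ (_ , _ , ()))
    ... | inj₂ (inj₂ (inj₁ (_ , _ , ())))
    ... | inj₂ (inj₂ (inj₂ (inj₁ (_ , _ , ()))))
    ... | inj₂ (inj₂ (inj₂ (inj₂ (_ , _ , ()))))

    firstIs⇒ : ∀ X r → firstIs X r ≡ true → lookup r Fin.zero ≡ X
    firstIs⇒ X r holds = ==ᴰ⇒≡ _ X (blockwise-first _ _ _ _ _ r holds)

    firstIs-false⇒ : ∀ X r → firstIs X r ≡ false → lookup r Fin.zero ≢ X
    firstIs-false⇒ X r fails = ==ᴰ-false⇒≢ _ X (blockwise-first-false (_==ᴰ X) r fails)

    firstIsNot⇒ : ∀ X r → firstIsNot X r ≡ true → lookup r Fin.zero ≢ X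
    firstIsNot⇒ X r holds = ==ᴰ-false⇒≢ _ X (not-injective (blockwise-first _ _ _ _ _ r holds))

    firstIsNot-false⇒ : ∀ X r → firstIsNot X r ≡ false → lookup r Fin.zero ≡ X
    firstIsNot-false⇒ X r fails = ==ᴰ⇒≡ _ X (not-injective (blockwise-first-false (λ d → not (d ==ᴰ X)) r fails))

    corner : Board size → Dir
    corner A = entry A (Fin.zero , Fin.zero)

    cornerIs⇒ : ∀ X A → cornerIs X A ≡ true → corner A ≡ X
    cornerIs⇒ X A holds = firstIs⇒ X (lookup A Fin.zero) (blockwise-first _ _ _ _ _ A holds)

    cornerIs-false⇒ : ∀ X A → cornerIs X A ≡ false → corner A ≢ X
    cornerIs-false⇒ X A fails = firstIs-false⇒ X (lookup A Fin.zero) (blockwise-first-false (firstIs X) A fails)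

    southNoTwo⇒corner : ∀ A → southNoTwo A ≡ true → corner A ≡ S
    southNoTwo⇒corner A holds = firstIs⇒ S (lookup A Fin.zero) (blockwise-first _ _ _ _ _ A holds)

    origin : Pos size
    origin = Fin.zero , Fin.zero

    centreFin : Fin size
    centreFin = Fin.fromℕ< centre<size

    toℕ-centreFin : toℕ centreFin ≡ centre
    toℕ-centreFin = toℕ-fromℕ< centre<size

    IsStart⇒origin : ∀ p → IsStart p → p ≡ origin
    IsStart⇒origin (Fin.zero , Fin.zero) _ = refl

    IsCenter⇒ : ∀ (q : Pos size) → IsCenter q → toℕ (proj₁ q) ≡ centre × toℕ (proj₂ q) ≡ centre
    IsCenter⇒ (i , j) (i≡ , j≡) = trans i≡ size/2≡centre , trans j≡ size/2≡centre

    IsCenter-diagonal : ∀ (i : Fin size) → toℕ i ≡ centre → IsCenter (i , i)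
    IsCenter-diagonal i i≡c = trans i≡c (sym size/2≡centre) , trans i≡c (sym size/2≡centre)

    solution : ∀ {A : Board size} {k} i → toℕ i ≡ centre → Path A k origin (i , i) → SolvesIn A k
    solution i i≡c path = origin , (i , i) , (refl , refl) , IsCenter-diagonal i i≡c , path

    module _ (A : Board size) where

      first-move-south : ∀ {i j} → corner A ≡ S → Move A origin (i , j) → toℕ j ≡ 0 × 0 < toℕ i
      first-move-south {i} {j} cornerS move = subst (λ d → DirectsTo d 0 0 (toℕ i) (toℕ j)) cornerS move

      south : ∀ i → corner A ≡ S → 0 < toℕ i → Move A origin (i , Fin.zero)
      south i cornerS 0<i = subst (λ d → DirectsTo d 0 0 (toℕ i) 0) (sym cornerS) (refl , 0<i)

      no-solution-0 : ¬ SolvesIn A 0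
      no-solution-0 (p , .p , start , centred , stop) with IsStart⇒origin p start
      ... | refl with proj₁ (IsCenter⇒ p centred)
      ... | ()

      no-solution-1 : corner A ≡ S → ¬ SolvesIn A 1
      no-solution-1 cornerS (p , q , start , centred , step move stop) with IsStart⇒origin p start
      ... | refl with trans (sym (proj₂ (IsCenter⇒ q centred))) (proj₁ (first-move-south cornerS move))
      ... | ()

      no-solution-2 : southNoTwo A ≡ true → ¬ SolvesIn A 2
      no-solution-2 noTwo (p , (i₂ , j₂) , start , centred , step {q = i₁ , j₁} move₁ (step move₂ stop))
        with IsStart⇒origin p start
      ... | refl with first-move-south (southNoTwo⇒corner A noTwo) move₁
      ... | j₁≡0 , 0<i₁ with toℕ-injective {i = j₁} {j = Fin.zero} j₁≡0
      ... | refl with IsCenter⇒ (i₂ , j₂) centred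
      ... | i₂≡c , j₂≡c
        with moves-from-first-column (entry A (i₁ , Fin.zero)) (toℕ i₁) centre 0<i₁ (s≤s z≤n)
               (subst₂ (DirectsTo (entry A (i₁ , Fin.zero)) (toℕ i₁) 0) i₂≡c j₂≡c move₂)
      ... | inj₁ (east , i₁≡c) =
        firstIsNot⇒ E (lookup A i₁) (blockwise-centre _ _ _ _ _ A noTwo i₁ i₁≡c) east
      ... | inj₂ (northeast , i₁≡c+c) =
        firstIsNot⇒ NE (lookup A i₁) (blockwise-bottom _ _ _ _ _ A noTwo i₁ (trans i₁≡c+c (cong suc (+-suc t t))))
                    northeast

      solution-1 : corner A ≡ SE → SolvesIn A 1
      solution-1 cornerSE = solution centreFin toℕ-centreFin (step diagonal stop)
        where
        diagonal : Move A origin (centreFin , centreFin)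
        diagonal = subst (λ d → DirectsTo d 0 0 (toℕ centreFin) (toℕ centreFin)) (sym cornerSE)
                         (subst (λ c → DirectsTo SE 0 0 c c) (sym toℕ-centreFin) (s≤s z≤n , s≤s z≤n , refl))

      solution-2 : corner A ≡ S → southNoTwo A ≡ false → SolvesIn A 2
      solution-2 cornerS twoFails with blockwise-false _ _ _ _ _ A twoFails
      ... | inj₁ fails = ⊥-elim (firstIs-false⇒ S (lookup A Fin.zero) fails cornerS)
      ... | inj₂ (inj₁ (_ , _ , ()))
      ... | inj₂ (inj₂ (inj₂ (inj₁ (_ , _ , ()))))
      ... | inj₂ (inj₂ (inj₁ (i , i≡c , fails))) =
        solution i i≡c (step (south i cornerS 0<i) (step east stop))
        where
        0<i : 0 < toℕ i
        0<i = subst (0 <_) (sym i≡c) (s≤s z≤n)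
        east : Move A (i , Fin.zero) (i , i)
        east = subst (λ d → DirectsTo d (toℕ i) 0 (toℕ i) (toℕ i)) (sym (firstIsNot-false⇒ E (lookup A i) fails))
                     (refl , 0<i)
      ... | inj₂ (inj₂ (inj₂ (inj₂ (i , i≡b , fails)))) =
        solution centreFin toℕ-centreFin (step (south i cornerS 0<i) (step northeast stop))
        where
        0<i : 0 < toℕ i
        0<i = subst (0 <_) (sym i≡b) (s≤s z≤n)
        northeast : Move A (i , Fin.zero) (centreFin , centreFin)
        northeast = subst₂ (λ d c → DirectsTo d (toℕ i) 0 c c)
          (sym (firstIsNot-false⇒ NE (lookup A i) fails)) (sym toℕ-centreFin)
          (subst (λ b → DirectsTo NE b 0 centre centre) (sym i≡b)
                 (s≤s (s≤s (m≤m+n t t)) , s≤s z≤n , m+n∸n≡m (suc t) t))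

      solution-3 : southNoTwo A ≡ true → southNoThree A ≡ false → SolvesIn A 3
      solution-3 noTwo threeFails with blockwise-false _ _ _ _ _ A threeFails
      ... | inj₁ fails with trans (sym fails) (blockwise-first _ _ _ _ _ A noTwo)
      ...   | ()
      solution-3 noTwo threeFails | inj₂ (inj₂ (inj₁ (i , i≡c , fails)))
        with trans (sym fails) (blockwise-centre _ _ _ _ _ A noTwo i i≡c)
      ...   | ()
      solution-3 noTwo threeFails | inj₂ (inj₂ (inj₂ (inj₂ (i , i≡b , fails))))
        with trans (sym fails) (blockwise-bottom _ _ _ _ _ A noTwo i i≡b)
      ...   | ()
      solution-3 noTwo threeFails | inj₂ (inj₂ (inj₂ (inj₁ (_ , _ , ()))))
      solution-3 noTwo threeFails | inj₂ (inj₁ (i , (0<i , i<c) , fails)) =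
        solution centreFin toℕ-centreFin
          (step (south i (southNoTwo⇒corner A noTwo) 0<i) (step east (step south′ stop)))
        where
        detour : eastThenSouth (lookup A i) ≡ true
        detour = not-injective fails
        east : Move A (i , Fin.zero) (i , centreFin)
        east = subst (λ d → DirectsTo d (toℕ i) 0 (toℕ i) (toℕ centreFin))
          (sym (==ᴰ⇒≡ _ E (blockwise-first _ _ _ _ _ (lookup A i) detour)))
          (refl , subst (0 <_) (sym toℕ-centreFin) (s≤s z≤n))
        south′ : Move A (i , centreFin) (centreFin , centreFin)
        south′ = subst (λ d → DirectsTo d (toℕ i) (toℕ centreFin) (toℕ centreFin) (toℕ centreFin))
          (sym (==ᴰ⇒≡ _ S (blockwise-centre _ _ _ _ _ (lookup A i) detour centreFin toℕ-centreFin)))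
          (refl , subst (toℕ i <_) (sym toℕ-centreFin) i<c)

      length-1 : cornerIs SE A ≡ true → IsLength A 1
      length-1 cornerSE = solution-1 (cornerIs⇒ SE A cornerSE) , λ where
        zero    _             → no-solution-0
        (suc _) (s≤s ())

      length-2 : cornerIs S A ≡ true → southNoTwo A ≡ false → IsLength A 2
      length-2 cornerS twoFails = solution-2 (cornerIs⇒ S A cornerS) twoFails , λ where
        zero          _                → no-solution-0
        (suc zero)    _                → no-solution-1 (cornerIs⇒ S A cornerS)
        (suc (suc _)) (s≤s (s≤s ()))

      length-3 : southNoTwo A ≡ true → southNoThree A ≡ false → IsLength A 3
      length-3 noTwo threeFails = solution-3 noTwo threeFails , λ where
        zero                _                     → no-solution-0
        (suc zero)          _                     → no-solution-1 (southNoTwo⇒corner A noTwo)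
        (suc (suc zero))    _                     → no-solution-2 noTwo
        (suc (suc (suc _))) (s≤s (s≤s (s≤s ())))

      unsolvable : cornerIs SE A ≡ false → cornerIs S A ≡ false → cornerIs S (transposeBoard A) ≡ false →
                   ¬ Solvable A
      unsolvable notSE notS notE (zero , solves) = no-solution-0 solves
      unsolvable notSE notS notE (suc k , p , q , start , _ , step {q = i , j} move _)
        with IsStart⇒origin p start
      ... | refl with moves-from-origin (corner A) (toℕ i) (toℕ j) move
      ... | inj₁ cornerSE         = cornerIs-false⇒ SE A notSE cornerSE
      ... | inj₂ (inj₁ cornerS)   = cornerIs-false⇒ S A notS cornerS
      ... | inj₂ (inj₂ cornerE)   =
        cornerIs-false⇒ S (transposeBoard A) notE (trans (entry-transposeBoard A origin) (cong mirror cornerE))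

    rowsWithFirst rowsWithFirstAndCentre rowsAll : ℕ
    rowsWithFirst          = 8 ^ t * (8 * (8 ^ t * 8))
    rowsWithFirstAndCentre = 8 ^ t * (8 ^ t * 8)
    rowsAll                = 8 ^ size

    count-rows : count (const true) rows ≡ rowsAll
    count-rows = count-vectors size allDirs

    count-firstIs : ∀ X → count (firstIs X) rows ≡ rowsWithFirst
    count-firstIs X = trans (count-blockwise _ _ _ _ _ allDirs)
                            (trans (cong (_* rowsWithFirst) (count-==ᴰ X)) (*-identityˡ rowsWithFirst))

    count-firstIsNot : ∀ X → count (firstIsNot X) rows ≡ 7 * rowsWithFirst
    count-firstIsNot X = trans (count-blockwise _ _ _ _ _ allDirs) (cong (_* rowsWithFirst) (count-≠ᴰ X))

    count-eastThenSouth : count eastThenSouth rows ≡ rowsWithFirstAndCentre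
    count-eastThenSouth = begin
      count eastThenSouth rows
        ≡⟨ count-blockwise _ _ _ _ _ allDirs ⟩
      count (_==ᴰ E) allDirs * (8 ^ t * (count (_==ᴰ S) allDirs * (8 ^ t * 8)))
        ≡⟨ cong₂ (λ e s → e * (8 ^ t * (s * (8 ^ t * 8)))) (count-==ᴰ E) (count-==ᴰ S) ⟩
      1 * (8 ^ t * (1 * (8 ^ t * 8)))
        ≡⟨ trans (*-identityˡ _) (cong (8 ^ t *_) (*-identityˡ _)) ⟩
      rowsWithFirstAndCentre ∎
      where open ≡-Reasoning

    rowsWithoutDetour : ℕ
    rowsWithoutDetour = count (λ r → not (eastThenSouth r)) rows

    rowsWithoutDetour+ : rowsWithoutDetour + rowsWithFirstAndCentre ≡ rowsAll
    rowsWithoutDetour+ = begin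
      rowsWithoutDetour + rowsWithFirstAndCentre
        ≡⟨ cong (rowsWithoutDetour +_) count-eastThenSouth ⟨
      rowsWithoutDetour + count eastThenSouth rows
        ≡⟨ sumWhere-split (const true) eastThenSouth (λ _ → 1) rows (λ _ _ → refl) ⟨
      count (const true) rows
        ≡⟨ count-rows ⟩
      rowsAll ∎
      where open ≡-Reasoning

    count-cornerIs : ∀ X → count (cornerIs X) (boards size) ≡
      rowsWithFirst * (rowsAll ^ t * (rowsAll * (rowsAll ^ t * rowsAll)))
    count-cornerIs X = trans (cong (count (cornerIs X)) (boards≡vectors size)) (
      trans (count-blockwise (firstIs X) (const true) (const true) (const true) (const true) rows)
            (cong₂ (λ u r → u * (r ^ t * (r * (r ^ t * r)))) (count-firstIs X) count-rows))

    count-southNoTwo : count southNoTwo (boards size) ≡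
      rowsWithFirst * (rowsAll ^ t * (7 * rowsWithFirst * (rowsAll ^ t * (7 * rowsWithFirst))))
    count-southNoTwo = begin
      count southNoTwo (boards size)
        ≡⟨ cong (count southNoTwo) (boards≡vectors size) ⟩
      count southNoTwo (vectors size rows)
        ≡⟨ count-blockwise (firstIs S) (const true) (firstIsNot E) (const true) (firstIsNot NE) rows ⟩
      count (firstIs S) rows * (count (const true) rows ^ t *
        (count (firstIsNot E) rows * (count (const true) rows ^ t * count (firstIsNot NE) rows)))
        ≡⟨ cong₂ (λ u r → u * (r ^ t * (count (firstIsNot E) rows * (r ^ t * count (firstIsNot NE) rows))))
                 (count-firstIs S) count-rows ⟩
      rowsWithFirst * (rowsAll ^ t * (count (firstIsNot E) rows * (rowsAll ^ t * count (firstIsNot NE) rows)))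
        ≡⟨ cong₂ (λ e n → rowsWithFirst * (rowsAll ^ t * (e * (rowsAll ^ t * n))))
                 (count-firstIsNot E) (count-firstIsNot NE) ⟩
      rowsWithFirst * (rowsAll ^ t * (7 * rowsWithFirst * (rowsAll ^ t * (7 * rowsWithFirst)))) ∎
      where open ≡-Reasoning

    count-southNoThree : count southNoThree (boards size) ≡
      rowsWithFirst * (rowsWithoutDetour ^ t * (7 * rowsWithFirst * (rowsAll ^ t * (7 * rowsWithFirst))))
    count-southNoThree = begin
      count southNoThree (boards size)
        ≡⟨ cong (count southNoThree) (boards≡vectors size) ⟩
      count southNoThree (vectors size rows)
        ≡⟨ count-blockwise (firstIs S) (λ r → not (eastThenSouth r)) (firstIsNot E) (const true) (firstIsNot NE) rows ⟩
      count (firstIs S) rows * (rowsWithoutDetour ^ t *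
        (count (firstIsNot E) rows * (count (const true) rows ^ t * count (firstIsNot NE) rows)))
        ≡⟨ cong₂ (λ u r → u * (rowsWithoutDetour ^ t * (count (firstIsNot E) rows * (r ^ t * count (firstIsNot NE) rows))))
                 (count-firstIs S) count-rows ⟩
      rowsWithFirst * (rowsWithoutDetour ^ t * (count (firstIsNot E) rows * (rowsAll ^ t * count (firstIsNot NE) rows)))
        ≡⟨ cong₂ (λ e n → rowsWithFirst * (rowsWithoutDetour ^ t * (e * (rowsAll ^ t * n))))
                 (count-firstIsNot E) (count-firstIsNot NE) ⟩
      rowsWithFirst * (rowsWithoutDetour ^ t * (7 * rowsWithFirst * (rowsAll ^ t * (7 * rowsWithFirst)))) ∎
      where open ≡-Reasoning

    rowsAll≡8*rowsWithFirst : rowsAll ≡ 8 * rowsWithFirst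
    rowsAll≡8*rowsWithFirst =
      trans (cong (λ m → 8 * (8 * (8 * m))) (^-distribˡ-+-* 8 t t)) (8³a²≡8a[8a8] (8 ^ t))
      where
      8³a²≡8a[8a8] : ∀ a → 8 * (8 * (8 * (a * a))) ≡ 8 * (a * (8 * (a * 8)))
      8³a²≡8a[8a8] = solve-∀

    rowsWithFirst≡8*rowsWithFirstAndCentre : rowsWithFirst ≡ 8 * rowsWithFirstAndCentre
    rowsWithFirst≡8*rowsWithFirstAndCentre = a[8[a8]]≡8[a[a8]] (8 ^ t)
      where
      a[8[a8]]≡8[a[a8]] : ∀ a → a * (8 * (a * 8)) ≡ 8 * (a * (a * 8))
      a[8[a8]]≡8[a[a8]] = solve-∀

    rowsWithoutDetour≡63* : rowsWithoutDetour ≡ 63 * rowsWithFirstAndCentre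
    rowsWithoutDetour≡63* = +-cancelʳ-≡ rowsWithFirstAndCentre _ _ (begin
      rowsWithoutDetour + rowsWithFirstAndCentre  ≡⟨ rowsWithoutDetour+ ⟩
      rowsAll                                     ≡⟨ rowsAll≡8*rowsWithFirst ⟩
      8 * rowsWithFirst                           ≡⟨ cong (8 *_) rowsWithFirst≡8*rowsWithFirstAndCentre ⟩
      8 * (8 * rowsWithFirstAndCentre)            ≡⟨ 64w≡63w+w rowsWithFirstAndCentre ⟩
      63 * rowsWithFirstAndCentre + rowsWithFirstAndCentre ∎)
      where
      open ≡-Reasoning
      64w≡63w+w : ∀ w → 8 * (8 * w) ≡ 63 * w + w
      64w≡63w+w = solve-∀

    -- Z is 1/64 of the number of boards with a prescribed corner.
    Z : ℕ
    Z = rowsWithFirst * (rowsAll ^ t * (rowsWithFirst * (rowsAll ^ t * rowsWithFirst)))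

    rowsWithFirstAndCentre>0 : 0 < rowsWithFirstAndCentre
    rowsWithFirstAndCentre>0 = *-pos (8 ^ t) (8 ^ t * 8) (m^n>0 8 t) (*-pos (8 ^ t) 8 (m^n>0 8 t) (s≤s z≤n))

    Z>0 : 0 < Z
    Z>0 = *-pos _ _ u>0 (*-pos _ _ Rᵗ>0 (*-pos _ _ u>0 (*-pos _ _ Rᵗ>0 u>0)))
      where
      u>0 : 0 < rowsWithFirst
      u>0 = *-pos (8 ^ t) (8 * (8 ^ t * 8)) (m^n>0 8 t) (*-pos 8 (8 ^ t * 8) (s≤s z≤n) (*-pos (8 ^ t) 8 (m^n>0 8 t) (s≤s z≤n)))
      Rᵗ>0 : 0 < rowsAll ^ t
      Rᵗ>0 = m^n>0 rowsAll {{>-nonZero (m^n>0 8 size)}} t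

    count-cornerIs≡64Z : ∀ X → count (cornerIs X) (boards size) ≡ 64 * Z
    count-cornerIs≡64Z X =
      trans (count-cornerIs X)
            (trans (cong (λ r → rowsWithFirst * (rowsAll ^ t * (r * (rowsAll ^ t * r)))) rowsAll≡8*rowsWithFirst)
                   (u[r[8u[r8u]]]≡64Z rowsWithFirst (rowsAll ^ t)))
      where
      u[r[8u[r8u]]]≡64Z : ∀ u r → u * (r * (8 * u * (r * (8 * u)))) ≡ 64 * (u * (r * (u * (r * u))))
      u[r[8u[r8u]]]≡64Z = solve-∀

    count-southNoTwo≡49Z : count southNoTwo (boards size) ≡ 49 * Z
    count-southNoTwo≡49Z = trans count-southNoTwo (u[r[7u[r7u]]]≡49Z rowsWithFirst (rowsAll ^ t))
      where
      u[r[7u[r7u]]]≡49Z : ∀ u r → u * (r * (7 * u * (r * (7 * u)))) ≡ 49 * (u * (r * (u * (r * u))))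
      u[r[7u[r7u]]]≡49Z = solve-∀

    q K : ℕ
    q = size * size
    K = count southNoThree (boards size)

    count-southNoThree*64^t : K * 64 ^ t ≡ 49 * 63 ^ t * Z
    count-southNoThree*64^t = *-cancelʳ-≡ _ _ (w ^ t) {{m^n≢0 w t {{>-nonZero rowsWithFirstAndCentre>0}}}} (begin
      K * 64 ^ t * w ^ t        ≡⟨ *-assoc K (64 ^ t) (w ^ t) ⟩
      K * (64 ^ t * w ^ t)      ≡⟨ cong (K *_) (*-^-distrib 64 w t) ⟨
      K * (64 * w) ^ t          ≡⟨ cong (λ r → K * r ^ t) 64w≡rowsAll ⟩
      K * rowsAll ^ t           ≡⟨ cong (_* rowsAll ^ t) count-southNoThree ⟩
      _                         ≡⟨ u[v[7u[r7u]]]r≡49vZ rowsWithFirst (rowsWithoutDetour ^ t) (rowsAll ^ t) ⟩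
      49 * rowsWithoutDetour ^ t * Z ≡⟨ cong (λ v → 49 * v ^ t * Z) rowsWithoutDetour≡63* ⟩
      49 * (63 * w) ^ t * Z     ≡⟨ cong (λ v → 49 * v * Z) (*-^-distrib 63 w t) ⟩
      49 * (63 ^ t * w ^ t) * Z ≡⟨ 49[bc]Z≡49bZc (63 ^ t) (w ^ t) Z ⟩
      49 * 63 ^ t * Z * w ^ t   ∎)
      where
      open ≡-Reasoning
      w : ℕ
      w = rowsWithFirstAndCentre
      64w≡rowsAll : 64 * w ≡ rowsAll
      64w≡rowsAll = sym (trans rowsAll≡8*rowsWithFirst (trans (cong (8 *_) rowsWithFirst≡8*rowsWithFirstAndCentre)
                                                              (sym (*-assoc 8 8 w))))
      u[v[7u[r7u]]]r≡49vZ : ∀ u v r → u * (v * (7 * u * (r * (7 * u)))) * r ≡ 49 * v * (u * (r * (u * (r * u))))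
      u[v[7u[r7u]]]r≡49vZ = solve-∀
      49[bc]Z≡49bZc : ∀ b c z → 49 * (b * c) * z ≡ 49 * b * z * c
      49[bc]Z≡49bZc = solve-∀

    few-long-boards : ∀ d → threshold d ≤ t → 576 * q * K * d < 6144 * Z
    few-long-boards d t-large =
      rare-class-bound q d K Z (63 ^ t) (64 ^ t) Z>0 count-southNoThree*64^t (63^t-negligible t d t-large)

    cornerIs-other : ∀ X Y A → corner A ≡ Y → Y ≢ X → cornerIs X A ≡ false
    cornerIs-other X Y A corner≡Y Y≢X with cornerIs X A in holds
    ... | true  = ⊥-elim (Y≢X (trans (sym corner≡Y) (cornerIs⇒ X A holds)))
    ... | false = refl

    corner-transposeBoard : ∀ A → corner (transposeBoard A) ≡ mirror (corner A)
    corner-transposeBoard A = entry-transposeBoard A origin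

    southNoTwo⇒cornerIs : ∀ A → southNoTwo A ≡ true → cornerIs S A ≡ true
    southNoTwo⇒cornerIs A noTwo with cornerIs S A in holds
    ... | true  = refl
    ... | false = ⊥-elim (cornerIs-false⇒ S A holds (southNoTwo⇒corner A noTwo))

    southNoThree⇒southNoTwo : ∀ A → southNoThree A ≡ true → southNoTwo A ≡ true
    southNoThree⇒southNoTwo = blockwise-mono
      (firstIs S) (λ r → not (eastThenSouth r)) (firstIsNot E) (const true) (firstIsNot NE)
      (firstIs S) (const true)                  (firstIsNot E) (const true) (firstIsNot NE)
      (λ _ → id) (λ _ _ → refl) (λ _ → id) (λ _ → id) (λ _ → id)

    count-transposeBoard : ∀ p → count (λ A → p (transposeBoard A)) (boards size) ≡ count p (boards size)
    count-transposeBoard p =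
      count-involution transposeBoard transposeBoard-involutive p (boards size) (boards-unique size) ∈-boards

    module Mean (bs : List (Board size)) (bs-unique : Unique bs)
                (∈bs⇔solvable : (A : Board size) → (A ∈ bs) ⇔ Solvable A)
                (ℓ : Board size → ℕ) (ℓ-length : (A : Board size) → A ∈ bs → IsLength A (ℓ A)) where

      count-bs : ∀ p → (∀ A → p A ≡ true → Solvable A) → count p bs ≡ count p (boards size)
      count-bs p solvable = count-≡ p bs (boards size) bs-unique (boards-unique size)
        (λ A _ _ → ∈-boards A) (λ A pA _ → Equivalence.from (∈bs⇔solvable A) (solvable A pA))

      count-bs-≤ : ∀ p → count p bs ≤ count p (boards size)
      count-bs-≤ p = count-mono p bs (boards size) bs-unique (λ A _ _ → ∈-boards A)

      -- g = id covers the boards with corner S, g = transposeBoard those with corner E.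
      module Branch (g : Board size → Board size)
                    (ℓ≡ : ∀ {A m} → A ∈ bs → IsLength (g A) m → ℓ A ≡ m)
                    (solvable : ∀ {A m} → IsLength (g A) m → Solvable A)
                    (count-g : ∀ p → count (λ A → p (g A)) (boards size) ≡ count p (boards size)) where

        s n k : Board size → Bool
        s A = cornerIs S (g A)
        n A = southNoTwo (g A)
        k A = southNoThree (g A)

        two : ∀ A → s A ∧ not (n A) ≡ true → IsLength (g A) 2
        two A holds = length-2 (g A) (∧-conicalˡ (s A) _ holds) (not-injective (∧-conicalʳ (s A) _ holds))

        three : ∀ A → n A ∧ not (k A) ≡ true → IsLength (g A) 3
        three A holds = length-3 (g A) (∧-conicalˡ (n A) _ holds) (not-injective (∧-conicalʳ (n A) _ holds))

        n⇒s : ∀ A → n A ≡ true → s A ≡ true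
        n⇒s A = southNoTwo⇒cornerIs (g A)

        k⇒n : ∀ A → k A ≡ true → n A ≡ true
        k⇒n A = southNoThree⇒southNoTwo (g A)

        x y c σ : ℕ
        x = count (λ A → s A ∧ not (n A)) bs
        y = count (λ A → n A ∧ not (k A)) bs
        c = count k bs
        σ = sumWhere k ℓ bs

        sum-ℓ≡ : sumWhere s ℓ bs ≡ 2 * x + (3 * y + σ)
        sum-ℓ≡ = begin
          sumWhere s ℓ bs
            ≡⟨ sumWhere-split s n ℓ bs n⇒s ⟩
          sumWhere (λ A → s A ∧ not (n A)) ℓ bs + sumWhere n ℓ bs
            ≡⟨ cong₂ _+_ (sumWhere-const _ ℓ 2 bs (λ A A∈ holds → ℓ≡ A∈ (two A holds)))
                         (sumWhere-split n k ℓ bs k⇒n) ⟩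
          2 * x + (sumWhere (λ A → n A ∧ not (k A)) ℓ bs + σ)
            ≡⟨ cong (λ m → 2 * x + (m + σ)) (sumWhere-const _ ℓ 3 bs (λ A A∈ holds → ℓ≡ A∈ (three A holds))) ⟩
          2 * x + (3 * y + σ) ∎
          where open ≡-Reasoning

        count-s≡ : count s bs ≡ x + (y + c)
        count-s≡ = trans (sumWhere-split s n _ bs n⇒s) (cong (x +_) (sumWhere-split n k _ bs k⇒n))

        x+49Z≡64Z : x + 49 * Z ≡ 64 * Z
        x+49Z≡64Z = begin
          x + 49 * Z
            ≡⟨ cong₂ _+_ (count-bs _ (λ A holds → solvable (two A holds)))
                         (sym (trans (count-g southNoTwo) count-southNoTwo≡49Z)) ⟩
          count (λ A → s A ∧ not (n A)) (boards size) + count n (boards size)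
            ≡⟨ sumWhere-split s n _ (boards size) n⇒s ⟨
          count s (boards size)
            ≡⟨ trans (count-g (cornerIs S)) (count-cornerIs≡64Z S) ⟩
          64 * Z ∎
          where open ≡-Reasoning

        y+K≡49Z : y + K ≡ 49 * Z
        y+K≡49Z = begin
          y + K
            ≡⟨ cong₂ _+_ (count-bs _ (λ A holds → solvable (three A holds))) (sym (count-g southNoThree)) ⟩
          count (λ A → n A ∧ not (k A)) (boards size) + count k (boards size)
            ≡⟨ sumWhere-split n k _ (boards size) k⇒n ⟨
          count n (boards size)
            ≡⟨ trans (count-g southNoTwo) count-southNoTwo≡49Z ⟩
          49 * Z ∎
          where open ≡-Reasoning

        c≤K : c ≤ K
        c≤K = ≤-trans (count-bs-≤ k) (≤-reflexive (count-g southNoThree))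

        σ≤qc : σ ≤ q * c
        σ≤qc = sumWhere-≤ k ℓ q bs (λ A A∈ _ → <⇒≤ (IsLength-< A (ℓ-length A A∈)))

        balance : BranchBalance Z K q (sumWhere s ℓ bs) (count s bs)
        balance = subst₂ (BranchBalance Z K q) (sym sum-ℓ≡) (sym count-s≡)
                         (branch-balance Z K q x y c σ x+49Z≡64Z y+K≡49Z c≤K σ≤qc)

      module Direct = Branch id (λ {A} A∈ → IsLength-unique A (ℓ-length A A∈)) (λ short → _ , proj₁ short) (λ _ → refl)
      module Transposed = Branch transposeBoard
        (λ {A} A∈ → IsLength-unique (transposeBoard A) (IsLength-transposeBoard A (ℓ-length A A∈)))
        (λ {A} short → _ , SolvesIn-transposeBoard⁻ A (proj₁ short))
        count-transposeBoard

      cornerSE cornerS cornerE : Board size → Bool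
      cornerSE = cornerIs SE
      cornerS  = cornerIs S
      cornerE A = cornerIs S (transposeBoard A)

      corner-of-cornerE : ∀ A → cornerE A ≡ true → corner A ≡ E
      corner-of-cornerE A holds = begin
        corner A                                 ≡⟨ mirror-involutive (corner A) ⟨
        mirror (mirror (corner A))               ≡⟨ cong mirror (corner-transposeBoard A) ⟨
        mirror (corner (transposeBoard A))       ≡⟨ cong mirror (cornerIs⇒ S (transposeBoard A) holds) ⟩
        E                                        ∎
        where open ≡-Reasoning

      cornerS⇒¬cornerSE : ∀ A → cornerS A ≡ true → not (cornerSE A) ≡ true
      cornerS⇒¬cornerSE A holds = cong not (cornerIs-other SE S A (cornerIs⇒ S A holds) (λ ()))

      cornerE⇒¬cornerSE∧¬cornerS : ∀ A → cornerE A ≡ true → not (cornerSE A) ∧ not (cornerS A) ≡ true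
      cornerE⇒¬cornerSE∧¬cornerS A holds
        rewrite cornerIs-other SE E A (corner-of-cornerE A holds) (λ ())
              | cornerIs-other S  E A (corner-of-cornerE A holds) (λ ()) = refl

      no-other-corners : ∀ A → A ∈ bs → (not (cornerSE A) ∧ not (cornerS A)) ∧ not (cornerE A) ≡ false
      no-other-corners A A∈ with cornerSE A in se | cornerS A in s | cornerE A in e
      ... | true  | _     | _     = refl
      ... | false | true  | _     = refl
      ... | false | false | true  = refl
      ... | false | false | false = ⊥-elim (unsolvable A se s e (Equivalence.to (∈bs⇔solvable A) A∈))

      sumWhere-by-corner : ∀ f → sumWhere (const true) f bs ≡
                           sumWhere cornerSE f bs + sumWhere cornerS f bs + sumWhere cornerE f bs
      sumWhere-by-corner f = begin
        sumWhere (const true) f bs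
          ≡⟨ sumWhere-split (const true) cornerSE f bs (λ _ _ → refl) ⟩
        sumWhere (λ A → not (cornerSE A)) f bs + sumWhere cornerSE f bs
          ≡⟨ cong (_+ sumWhere cornerSE f bs) (sumWhere-split _ cornerS f bs cornerS⇒¬cornerSE) ⟩
        sumWhere (λ A → not (cornerSE A) ∧ not (cornerS A)) f bs + sumWhere cornerS f bs + sumWhere cornerSE f bs
          ≡⟨ cong (λ m → m + sumWhere cornerS f bs + sumWhere cornerSE f bs)
                  (sumWhere-split _ cornerE f bs cornerE⇒¬cornerSE∧¬cornerS) ⟩
        sumWhere (λ A → (not (cornerSE A) ∧ not (cornerS A)) ∧ not (cornerE A)) f bs + sumWhere cornerE f bs
          + sumWhere cornerS f bs + sumWhere cornerSE f bs
          ≡⟨ cong (λ m → m + sumWhere cornerE f bs + sumWhere cornerS f bs + sumWhere cornerSE f bs)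
                  (sumWhere-none _ f bs no-other-corners) ⟩
        sumWhere cornerE f bs + sumWhere cornerS f bs + sumWhere cornerSE f bs
          ≡⟨ +-reverse₃ (sumWhere cornerE f bs) (sumWhere cornerS f bs) (sumWhere cornerSE f bs) ⟩
        sumWhere cornerSE f bs + sumWhere cornerS f bs + sumWhere cornerE f bs ∎
        where
        open ≡-Reasoning
        +-reverse₃ : ∀ a b c → a + b + c ≡ c + b + a
        +-reverse₃ = solve-∀

      count-cornerSE : count cornerSE bs ≡ 64 * Z
      count-cornerSE = trans (count-bs cornerSE (λ A holds → 1 , proj₁ (length-1 A holds))) (count-cornerIs≡64Z SE)

      length-bs : length bs ≡ 64 * Z + count cornerS bs + count cornerE bs
      length-bs = trans (sym (count-true bs)) (trans (sumWhere-by-corner (λ _ → 1))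
                        (cong (λ m → m + count cornerS bs + count cornerE bs) count-cornerSE))

      sum-lengths : sum (map ℓ bs) ≡ 64 * Z + sumWhere cornerS ℓ bs + sumWhere cornerE ℓ bs
      sum-lengths = trans (sum-map ℓ bs) (trans (sumWhere-by-corner ℓ)
        (cong (λ m → m + sumWhere cornerS ℓ bs + sumWhere cornerE ℓ bs)
              (trans (sumWhere-const cornerSE ℓ 1 bs (λ A A∈ holds → IsLength-unique A (ℓ-length A A∈) (length-1 A holds)))
                     (trans (*-identityˡ _) count-cornerSE))))

      mean-within : Within (576 * q * K) (96 * sum (map ℓ bs)) (209 * length bs)
      mean-within = subst₂ (λ a b → Within (576 * q * K) (96 * a) (209 * b)) (sym sum-lengths) (sym length-bs)
        (combine-balances Z K q _ _ _ _ (s≤s z≤n) Direct.balance Transposed.balance)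

      64Z≤length : 64 * Z ≤ length bs
      64Z≤length = ≤-trans (m≤m+n (64 * Z) _) (≤-trans (m≤m+n _ _) (≤-reflexive (sym length-bs)))

  MeanWithin : ℚ → ℕ → Set
  MeanWithin ε n =
    (bs : List (Board n)) → Unique bs → ((A : Board n) → (A ∈ bs) ⇔ Solvable A) →
    (ℓ : Board n → ℕ) → ((A : Board n) → A ∈ bs → IsLength A (ℓ A)) →
    ℚ.∣ mean (map ℓ bs) ℚ.- (ℤ.+ 209) ℚ./ 96 ∣ ℚ.< ε

  tThreshold : ℚ → ℕ
  tThreshold ε = threshold (suc (ℚ.denominator-1 ε))

  mean-close : ∀ t ε → 0ℚ ℚ.< ε → tThreshold ε ≤ t → MeanWithin ε (Family.size t)
  mean-close t ε 0<ε t-large [] bs-unique ∈bs⇔solvable ℓ ℓ-length =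
    ⊥-elim (<⇒≱ (*-monoʳ-< 64 Z>0) 64Z≤length)
    where
    open Family t
    open Mean [] bs-unique ∈bs⇔solvable ℓ ℓ-length
  mean-close t ε 0<ε t-large bs@(b ∷ bs′) bs-unique ∈bs⇔solvable ℓ ℓ-length =
    Within⇒ratio-close (sum (map ℓ bs)) (length (map ℓ bs′)) 209 95 (576 * q * K) ε 0<ε within small
    where
    open Family t
    open Mean bs bs-unique ∈bs⇔solvable ℓ ℓ-length
    within : Within (576 * q * K) (96 * sum (map ℓ bs)) (209 * suc (length (map ℓ bs′)))
    within = subst (λ l → Within (576 * q * K) (96 * sum (map ℓ bs)) (209 * suc l)) (sym (length-map ℓ bs′)) mean-within
    6144z≡96[64z] : ∀ z → 6144 * z ≡ 96 * (64 * z)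
    6144z≡96[64z] = solve-∀
    error<6144Z : 576 * q * K * suc (ℚ.denominator-1 ε) < 6144 * Z
    error<6144Z = few-long-boards (suc (ℚ.denominator-1 ε)) t-large
    6144Z≤96L : 6144 * Z ≤ 96 * suc (length (map ℓ bs′))
    6144Z≤96L = subst₂ _≤_ (sym (6144z≡96[64z] Z)) (cong (λ l → 96 * suc l) (sym (length-map ℓ bs′)))
                       (*-monoʳ-≤ 96 64Z≤length)
    small : 576 * q * K * suc (ℚ.denominator-1 ε) < 96 * suc (length (map ℓ bs′))
    small = <-≤-trans error<6144Z 6144Z≤96L

  odd⇒size : ∀ n → n % 2 ≡ 1 → 3 ≤ n → ∃ λ t → n ≡ Family.size t
  odd⇒size n odd 3≤n with n / 2 in n/2≡
  ... | zero  = ⊥-elim (<⇒≱ (subst (_< 3) (sym n≡1) (s≤s (s≤s z≤n))) 3≤n)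
    where
    n≡1 : n ≡ 1
    n≡1 = trans (m≡m%n+[m/n]*n n 2) (cong₂ _+_ odd (cong (_* 2) n/2≡))
  ... | suc t = t , trans (m≡m%n+[m/n]*n n 2) (trans (cong₂ _+_ odd (cong (_* 2) n/2≡)) (sym (3+m+m≡1+[1+m]*2 t)))

  size-cancel-≤ : ∀ {s t} → Family.size s ≤ Family.size t → s ≤ t
  size-cancel-≤ (s≤s (s≤s (s≤s s+s≤t+t))) = ≮⇒≥ (λ t<s → <⇒≱ (+-mono-< t<s t<s) s+s≤t+t)


open MeanLength using (MeanWithin; tThreshold; mean-close; odd⇒size; size-cancel-≤; module Family)

open import Data.Nat using (ℕ; _≤_; _%_)
open import Data.List using (List; map)
open import Data.List.Membership.Propositional using (_∈_)
open import Data.List.Relation.Unary.Unique.Propositional using (Unique)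
open import Data.Product using (∃; _×_; _,_)
open import Data.Integer using (+_)
open import Function.Bundles using (_⇔_)
open import Relation.Binary.PropositionalEquality using (_≡_; subst; sym)
open import Data.Rational using (ℚ; 0ℚ; _<_; _-_; ∣_∣; _/_)

theorem3p3 : (ε : ℚ) → 0ℚ < ε → ∃ λ (N : ℕ) →
    (n : ℕ) → n % 2 ≡ 1 → 3 ≤ n → N ≤ n →
    (bs : List (Board n)) → Unique bs → ((A : Board n) → (A ∈ bs) ⇔ Solvable A) →
    (ℓ : Board n → ℕ) → ((A : Board n) → A ∈ bs → IsLength A (ℓ A)) →
    ∣ mean (map ℓ bs) - (+ 209) / 96 ∣ < ε
theorem3p3 ε 0<ε = Family.size (tThreshold ε) , λ n odd 3≤n N≤n →
  let t , n≡size = odd⇒size n odd 3≤n in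
  subst (MeanWithin ε) (sym n≡size)
        (mean-close t ε 0<ε (size-cancel-≤ (subst (Family.size (tThreshold ε) ≤_) n≡size N≤n)))
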